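{- In the combinatorial Marker-Cutter game (with any initial counter $g_0$), if Marker has a strategy against restricted Cutter limiting the value of each game state to at most $t$, then Marker also has a strategy against (unrestricted) Cutter limiting the value of each game state to at most $t$.
   Context: A set of boundary cycles is a pair $(D,\chi)$: $D$ a finite directed graph each of whose components is a directed cycle (loops allowed, no isolated vertices), $\chi:E(D)\to L$ an edge labelling; it is proper if each label is used on at most two edges. The value $v(D,\chi)$ is the number of labels used. A game state is $\gamma=(D,\chi,g)$ with $(D,\chi)$ proper and $g\in\mathbb N_0$; $v(\gamma)=v(D,\chi)$. Combinatorial Marker-Cutter game: start with $D_0$ empty, $\chi_0$ empty, counter $g_0\in\mathbb N$. At turn $k$ with state $(D_k,\chi_k,g_k)$, Marker chooses $v,w$ (not necessarily distinct) from $V(D_k)\sqcup\{v_\gamma,w_\gamma\}$ ($v_\gamma,w_\gamma$ dummy vertices; each chosen dummy vertex, without multiplicity, is added as a new vertex). Let $C,C'$ be the components containing $v,w$ (a cycle or a single dummy vertex). Splitting a vertex $u$ replaces it by a source $u_1$ (incident to the out-edge) and a sink $u_2$ (incident to the in-edge). If $C=C'$: splitting $v$ and $w$ turns $C$ into a directed path $P$ from $v_1$ to $w_2$ and a directed path $P'$ from $w_1$ to $v_2$ (if $v=w$ is dummy, $v_1=w_2$, $v_2=w_1$ and the paths are trivial); add new edges $f=\overrightarrow{w_2v_1}$, $f'=\overrightarrow{v_2w_1}$, $\hat C_1=P\cup\{f\}$, $\hat C_2=P'\cup\{f'\}$; Cutter chooses (a) $D_{k+1}=\bar D\cup\hat C_1\cup\hat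 C_2$, $g_{k+1}=g_k-1$ (only if $g_k\ge1$); (b) $D_{k+1}=\bar D\cup\hat C_1$, $g_{k+1}=\bar g$; or (c) $D_{k+1}=\bar D\cup\hat C_2$, $g_{k+1}=\bar g$; where $\bar D$ is any union of components of $D_k\setminus C$ and $0\le\bar g\le g_k$. If $C\ne C'$: splitting turns $C$ into a path $P$ from $v_1$ to $v_2$ (trivial if $v$ dummy) and $C'$ into $P'$ from $w_1$ to $w_2$; new edges $f=\overrightarrow{w_2v_1}$, $f'=\overrightarrow{v_2w_1}$, $\hat C=P\cup P'\cup\{f,f'\}$; the only move is (d) $D_{k+1}=(D_k\cup\hat C)\setminus(C\cup C')$, $g_{k+1}=g_k$. In all cases $\chi_{k+1}$ extends $\chi_k$ and the new edges present receive one common new label not in the image of $\chi_k$. A contraction of $(D,\chi)$ contracts one edge of $D$ (deleting resulting isolated vertices). $(D',\chi',g')$ is a reduction of $(D,\chi,g)$ if $g'\le g$, $D'$ is obtained from $D$ by a sequence of contractions and $\chi'=\chi$ on $E(D')$. Two game states $(D,\chi,g)$ and $(D',\chi',g)$ are equivalent if there is an isomorphism $\psi:D\to D'$ of directed graphs and a bijection $\phi$ between their label sets with $\chi'\circ\psi=\phi\circ\chi$. Restricted Cutter is a Cutter who may never make a move producing a game state equivalent to a reduction of an earlier game state (including the current one), and who in moves (a), (b), (c) must take $\bar D=D_k\setminus C$ and $\bar g=g_k$; if restricted Cutter has no legal move, the game ends. -}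

module Defs where

open import Data.Nat using (ℕ; zero; suc; _∸_; _≤_; _≤ᵇ_; _⊔_)
open import Data.Nat.Properties using (_≟_)
open import Data.Fin as Fin using (Fin; toℕ)
open import Data.Bool using (Bool; true; false; if_then_else_; _∨_)
open import Data.List using (List; []; _∷_; [_]; _++_; length; lookup; map; concat; drop; take; foldr; deduplicate)
open import Data.List.Membership.Propositional using (_∈_)
open import Data.List.Relation.Unary.Any using (Any)
open import Data.List.Relation.Binary.Permutation.Propositional using (_↭_)
open import Data.List.Relation.Binary.Pointwise using (Pointwise)
open import Data.List.Relation.Binary.Sublist.Propositional using (_⊆_)
open import Relation.Binary.Construct.Closure.ReflexiveTransitive using (Star)
open import Relation.Binary.PropositionalEquality using (_≡_; _≢_)
open import Relation.Nullary using (¬_; does)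
open import Data.Product using (Σ; ∃; ∃-syntax; _×_; _,_)

-- Every component of D is a directed cycle, so D is determined (up to
-- renaming of vertices/edges) by its list of components, each component
-- being the cyclic sequence of the labels of its edges in the order in
-- which the directed cycle traverses them.  A cycle of length m given by
-- the list  e₀ ∷ … ∷ e_{m-1}  has vertices u₀ … u_{m-1} and edges
-- eᵢ : uᵢ → u_{i+1 mod m}  (a one-element list is a loop).

Cycle : Set
Cycle = List ℕ

Cycles : Set
Cycles = List Cycle

labels : Cycles → List ℕ
labels = concat

value : Cycles → ℕ
value D = length (deduplicate _≟_ (labels D))

fresh : Cycles → ℕ
fresh D = suc (foldr _⊔_ 0 (labels D))

-- proper: each label used on at most two edges (holds for all states
-- reached in the game; recorded here for reference)
count : ℕ → List ℕ → ℕ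
count a [] = 0
count a (b ∷ bs) = if does (a ≟ b) then suc (count a bs) else count a bs

Proper : Cycles → Set
Proper D = ∀ a → count a (labels D) ≤ 2

-- game state γ = (D , χ , g)
record State : Set where
  constructor ⟨_,_⟩
  field
    cyc : Cycles
    ctr : ℕ
open State public

-- Vertices available to Marker: V(D) ⊔ {v_γ , w_γ}.
-- real c p is vertex u_p of the c-th cycle.

data Vtx (D : Cycles) : Set where
  dummyV dummyW : Vtx D
  real : (c : Fin (length D)) → Fin (length (lookup D c)) → Vtx D

-- rotation of a cycle so that it starts at the out-edge of vertex u_p
rot : ℕ → Cycle → Cycle
rot p L = drop p L ++ take p L

dropIdx : (D : Cycles) → (Fin (length D) → Bool) → Cycles
dropIdx [] f = []
dropIdx (x ∷ xs) f = if f Fin.zero then dropIdx xs (λ i → f (Fin.suc i))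
                                   else x ∷ dropIdx xs (λ i → f (Fin.suc i))

data Outcome : Set where
  -- C = C' : the rest D_k ∖ C, and the two cycles Ĉ₁ , Ĉ₂
  same : (rest : Cycles) (C₁ C₂ : Cycle) → Outcome
  -- C ≠ C' : the rest (D_k ∖ (C ∪ C')) and the merged cycle Ĉ
  diff : (rest : Cycles) (C : Cycle) → Outcome

-- number of edges of the path P from v₁ to w₂ when v = u_p, w = u_q lie
-- on a common cycle of length m  (P = e_p … e_{q-1}, taken cyclically)
arcLen : ℕ → ℕ → ℕ → ℕ
arcLen m p q = if p ≤ᵇ q then q ∸ p else m ∸ (p ∸ q)

split : (D : Cycles) → Vtx D → Vtx D → Outcome
split D dummyV dummyV = same D [ fresh D ] [ fresh D ]
split D dummyW dummyW = same D [ fresh D ] [ fresh D ]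
split D dummyV dummyW = diff D (fresh D ∷ fresh D ∷ [])
split D dummyW dummyV = diff D (fresh D ∷ fresh D ∷ [])
split D dummyV (real c q) =
  diff (dropIdx D (λ i → does (i Fin.≟ c)))
       (fresh D ∷ rot (toℕ q) (lookup D c) ++ [ fresh D ])
split D dummyW (real c q) =
  diff (dropIdx D (λ i → does (i Fin.≟ c)))
       (fresh D ∷ rot (toℕ q) (lookup D c) ++ [ fresh D ])
split D (real c p) dummyV =
  diff (dropIdx D (λ i → does (i Fin.≟ c)))
       (rot (toℕ p) (lookup D c) ++ fresh D ∷ [ fresh D ])
split D (real c p) dummyW =
  diff (dropIdx D (λ i → does (i Fin.≟ c)))
       (rot (toℕ p) (lookup D c) ++ fresh D ∷ [ fresh D ])
split D (real c p) (real c' q) with does (c Fin.≟ c')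
... | true =
  -- P = e_p … e_{q-1},  P' = e_q … e_{p-1},  Ĉ₁ = P + f,  Ĉ₂ = P' + f'
  let L = lookup D c
      R = rot (toℕ p) L
      k = arcLen (length L) (toℕ p) (toℕ q)
  in same (dropIdx D (λ i → does (i Fin.≟ c)))
          (take k R ++ [ fresh D ]) (drop k R ++ [ fresh D ])
... | false =
  -- Ĉ = P (v₁ → v₂), f' , P' (w₁ → w₂), f
  diff (dropIdx D (λ i → does (i Fin.≟ c) ∨ does (i Fin.≟ c')))
       (rot (toℕ p) (lookup D c) ++ fresh D ∷ rot (toℕ q) (lookup D c') ++ [ fresh D ])

data Move (γ : State) (v w : Vtx (cyc γ)) : State → Set where
  moveA : ∀ {rest C₁ C₂ Dbar g'} → split (cyc γ) v w ≡ same rest C₁ C₂ →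
          Dbar ⊆ rest → ctr γ ≡ suc g' → Move γ v w ⟨ C₁ ∷ C₂ ∷ Dbar , g' ⟩
  moveB : ∀ {rest C₁ C₂ Dbar g'} → split (cyc γ) v w ≡ same rest C₁ C₂ →
          Dbar ⊆ rest → g' ≤ ctr γ → Move γ v w ⟨ C₁ ∷ Dbar , g' ⟩
  moveC : ∀ {rest C₁ C₂ Dbar g'} → split (cyc γ) v w ≡ same rest C₁ C₂ →
          Dbar ⊆ rest → g' ≤ ctr γ → Move γ v w ⟨ C₂ ∷ Dbar , g' ⟩
  moveD : ∀ {rest C} → split (cyc γ) v w ≡ diff rest C →
          Move γ v w ⟨ C ∷ rest , ctr γ ⟩

-- Cutter's moves with D̄ = D_k ∖ C and ḡ = g_k
data BasicMove (γ : State) (v w : Vtx (cyc γ)) : State → Set where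
  rmoveA : ∀ {rest C₁ C₂ g'} → split (cyc γ) v w ≡ same rest C₁ C₂ →
           ctr γ ≡ suc g' → BasicMove γ v w ⟨ C₁ ∷ C₂ ∷ rest , g' ⟩
  rmoveB : ∀ {rest C₁ C₂} → split (cyc γ) v w ≡ same rest C₁ C₂ →
           BasicMove γ v w ⟨ C₁ ∷ rest , ctr γ ⟩
  rmoveC : ∀ {rest C₁ C₂} → split (cyc γ) v w ≡ same rest C₁ C₂ →
           BasicMove γ v w ⟨ C₂ ∷ rest , ctr γ ⟩
  rmoveD : ∀ {rest C} → split (cyc γ) v w ≡ diff rest C →
           BasicMove γ v w ⟨ C ∷ rest , ctr γ ⟩

-- contract one edge (deleting the resulting isolated vertex if the edge
-- was a loop)
data Contract : Cycles → Cycles → Set where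
  contrEdge : ∀ xs ys as b cs → (as ++ cs) ≢ [] →
              Contract (xs ++ (as ++ b ∷ cs) ∷ ys) (xs ++ (as ++ cs) ∷ ys)
  contrLoop : ∀ xs ys b →
              Contract (xs ++ [ b ] ∷ ys) (xs ++ ys)

Reduction : State → State → Set
Reduction γ γ' = ctr γ' ≤ ctr γ × Star Contract (cyc γ) (cyc γ')

-- two cycles are equal as cyclic sequences (isomorphic directed cycles)
CycEq : Cycle → Cycle → Set
CycEq L L' = ∃[ k ] L' ≡ rot k L

-- equivalence of game states: a digraph isomorphism (matching cycles up
-- to rotation and reordering) together with a bijection φ between the
-- label sets with χ' ∘ ψ = φ ∘ χ
Equivalent : State → State → Set
Equivalent γ γ' =
  ctr γ ≡ ctr γ' ×
  Σ (ℕ → ℕ) λ φ →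
    (∀ {a b} → a ∈ labels (cyc γ) → b ∈ labels (cyc γ) → φ a ≡ φ b → a ≡ b) ×
    ∃[ E ] (Pointwise CycEq (map (map φ) (cyc γ)) E × E ↭ cyc γ')

-- a game history: the current state and the earlier states (most recent
-- first)
record History : Set where
  constructor hist
  field
    current : State
    past    : List State
open History public

states : History → List State
states h = current h ∷ past h

extend : History → State → History
extend h γ' = hist γ' (states h)

start : ℕ → History
start g₀ = hist ⟨ [] , g₀ ⟩ []

MarkerStrategy : Set
MarkerStrategy = (h : History) → Vtx (cyc (current h)) × Vtx (cyc (current h))

chV chW : MarkerStrategy → (h : History) → Vtx (cyc (current h))
chV σ h with σ h
... | v , _ = v
chW σ h with σ h
... | _ , w = w

RestrictedMove : (h : History) (v w : Vtx (cyc (current h))) → State → Set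
RestrictedMove h v w γ' =
  BasicMove (current h) v w γ' ×
  ¬ Any (λ γ → ∃[ ρ ] (Reduction γ ρ × Equivalent ρ γ')) (states h)

data Reachable (g₀ : ℕ) (σ : MarkerStrategy) : History → Set where
  init : Reachable g₀ σ (start g₀)
  step : ∀ {h γ'} → Reachable g₀ σ h →
         Move (current h) (chV σ h) (chW σ h) γ' →
         Reachable g₀ σ (extend h γ')

data RReachable (g₀ : ℕ) (σ : MarkerStrategy) : History → Set where
  init : RReachable g₀ σ (start g₀)
  step : ∀ {h γ'} → RReachable g₀ σ h →
         RestrictedMove h (chV σ h) (chW σ h) γ' →
         RReachable g₀ σ (extend h γ')

Limits : (MarkerStrategy → History → Set) → MarkerStrategy → ℕ → Set
Limits R σ t = ∀ h → R σ h → value (cyc (current h)) ≤ t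

MarkerWins : (g₀ t : ℕ) → Set
MarkerWins g₀ t = Σ MarkerStrategy λ σ → Limits (Reachable g₀) σ t

MarkerWinsRestricted : (g₀ t : ℕ) → Set
MarkerWinsRestricted g₀ t = Σ MarkerStrategy λ σ → Limits (RReachable g₀) σ t

module Submission where

-- Marker plays against Cutter while running σ in a shadow game against restricted Cutter.
-- The invariant is that the real state is a minor of the shadow state: its cycles arise from
-- distinct shadow cycles by contracting edges and relabelling, and its counter is no larger.
-- A minor has no larger value, so every real value is at most t. Marker's vertices in the
-- shadow state have images in the real state such that each answer of Cutter there is a minor
-- of some basic answer to σ's move in the shadow game. If restricted Cutter may not make that
-- answer, it is equivalent to a reduction of an earlier shadow state, hence a minor of it,
-- and the shadow game is rewound to that state; minors are decidable, so Marker can tell.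

open import Data.Bool using (Bool; true; false; _∨_; if_then_else_)
open import Data.Bool.Properties using (∨-comm; ∨-identityʳ)
open import Data.Empty using (⊥; ⊥-elim)
open import Data.Fin as Fin using (Fin; toℕ; fromℕ<)
open import Data.Fin.Properties using (toℕ-fromℕ<; toℕ<n)
open import Data.List using (List; []; _∷_; [_]; _++_; length; map; concatMap; deduplicate; drop; take; lookup; foldr)
open import Data.List.Membership.Propositional using (_∈_; find; lose)
open import Data.List.Membership.Propositional.Properties using (∈-∃++; ∈-++⁻; ∈-++⁺ˡ; ∈-++⁺ʳ; ∈-map⁺; ∈-map⁻; ∈-concat⁺′; ∈-concat⁻′; ∈-concatMap⁺; ∈-concatMap⁻; ∈-deduplicate⁺; ∈-deduplicate⁻)
open import Data.List.Properties using (++-assoc; ++-identityʳ; ++-conicalˡ; ++-conicalʳ; ∷-injective; length-++; length-++-sucʳ; length-map; map-++; map-∘; map-id; map-cong-local; take++drop≡id; take-map; drop-map; ≡-dec)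
open import Data.List.Relation.Binary.Permutation.Propositional as Perm using (_↭_; ↭-sym; ↭-trans; ↭-refl; ↭-reflexive)
open import Data.List.Relation.Binary.Permutation.Propositional.Properties using (shift; ∈-resp-↭; drop-mid; drop-∷; ++⁺ʳ)
open import Data.List.Relation.Binary.Pointwise as Pointwise using (Pointwise; []; _∷_)
import Data.List.Relation.Binary.Pointwise.Properties as Pointwise
open import Data.List.Relation.Binary.Sublist.Propositional using (_⊆_; []; _∷_; _∷ʳ_; ⊆-refl; ⊆-trans; minimum)
import Data.List.Relation.Binary.Sublist.Propositional.Properties as Sublist
open import Data.List.Relation.Unary.All using (All; []; _∷_; all?)
import Data.List.Relation.Unary.All as All
open import Data.List.Relation.Unary.AllPairs using (_∷_)
open import Data.List.Relation.Unary.Any using (Any; here; there; any?)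
open import Data.List.Relation.Unary.Unique.Propositional using (Unique)
open import Data.Maybe using (Maybe; just; nothing)
open import Data.Nat using (ℕ; zero; suc; _+_; _∸_; _⊔_; _<_; _≤_; _≤?_; _<?_; z≤n; s≤s; s≤s⁻¹)
open import Data.Nat.Properties using (_≟_; ≤-refl; ≤-trans; ≤-reflexive; <-irrefl; <-trans; <⇒≤; <⇒≱; ≮⇒≥; +-comm; m≤m+n; m<m+n; m+n∸m≡n; m+n∸n≡m; m∸[m∸n]≡n; m+[n∸m]≡n; m∸n+n≡m; ∸-+-assoc; ∸-monoˡ-≤; +-cancelʳ-<; +-monoʳ-<; m≤m⊔n; m≤n⇒m≤o⊔n)
open import Data.List.Relation.Binary.Sublist.DecPropositional (≡-dec _≟_) using (_⊆?_)
open import Data.List.Relation.Unary.Unique.DecPropositional.Properties _≟_ using (deduplicate-!)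
open import Data.Product using (∃; ∃₂; ∃-syntax; _×_; _,_; proj₁; proj₂)
open import Data.Sum using (_⊎_; inj₁; inj₂)
open import Function using (_∘_; id)
open import Relation.Binary.Construct.Closure.ReflexiveTransitive using (Star; ε; _◅_)
open import Relation.Binary.PropositionalEquality using (_≡_; _≢_; refl; sym; trans; cong; cong₂; subst; subst₂; module ≡-Reasoning)
open import Relation.Nullary using (Dec; yes; no; ¬_; does)
open import Relation.Nullary.Decidable using (_×-dec_; _⊎-dec_; _→-dec_; map′; dec-true; dec-false)

open import Defs

open ≡-Reasoning

private variable
  A B : Set

++-≡-++ : (P Q C D : List A) → P ++ Q ≡ C ++ D →
          (∃ λ W → C ≡ P ++ W × Q ≡ W ++ D) ⊎ (∃ λ W → P ≡ C ++ W × D ≡ W ++ Q)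
++-≡-++ []      Q C       D eq = inj₁ (C , refl , eq)
++-≡-++ (x ∷ P) Q []      D eq = inj₂ (x ∷ P , refl , sym eq)
++-≡-++ (x ∷ P) Q (y ∷ C) D eq with refl , eq′ ← ∷-injective eq with ++-≡-++ P Q C D eq′
... | inj₁ (W , refl , eq₂) = inj₁ (W , refl , eq₂)
... | inj₂ (W , refl , eq₂) = inj₂ (W , refl , eq₂)

Rotation : List A → List A → Set
Rotation L R = ∃₂ λ X Y → L ≡ X ++ Y × R ≡ Y ++ X

rotation-refl : (L : List A) → Rotation L L
rotation-refl L = [] , L , refl , sym (++-identityʳ L)

rotation-sym : {L R : List A} → Rotation L R → Rotation R L
rotation-sym (X , Y , eq₁ , eq₂) = Y , X , eq₂ , eq₁

rotation-trans : {L R S : List A} → Rotation L R → Rotation R S → Rotation L S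
rotation-trans (X , Y , refl , refl) (U , V , eq , refl) with ++-≡-++ Y X U V eq
... | inj₁ (W , refl , refl) = W , V ++ Y , ++-assoc W V Y , sym (++-assoc V Y W)
... | inj₂ (W , refl , refl) = X ++ U , W , sym (++-assoc X U W) , ++-assoc W X U

rot-rotation : (k : ℕ) (L : Cycle) → Rotation L (rot k L)
rot-rotation k L = take k L , drop k L , sym (take++drop≡id k L) , refl

rotation-map : (f : A → B) {M R : List A} → Rotation M R → Rotation (map f M) (map f R)
rotation-map f (X , Y , refl , refl) = map f X , map f Y , map-++ f X Y , map-++ f Y X

map-≡-++ : (f : A → B) (M : List A) {X Y : List B} → map f M ≡ X ++ Y →
           ∃₂ λ M₁ M₂ → M ≡ M₁ ++ M₂ × X ≡ map f M₁ × Y ≡ map f M₂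
map-≡-++ f M       {[]}    refl = [] , M , refl , refl , refl
map-≡-++ f (m ∷ M) {x ∷ X} eq with refl , eq′ ← ∷-injective eq with map-≡-++ f M {X} eq′
... | M₁ , M₂ , refl , refl , refl = m ∷ M₁ , M₂ , refl , refl , refl

rotation-map⁻ : (f : A → B) (M : List A) {R : List B} → Rotation (map f M) R →
                ∃ λ R₀ → R ≡ map f R₀ × Rotation M R₀
rotation-map⁻ f M (X , Y , eq , refl) with map-≡-++ f M {X} {Y} eq
... | M₁ , M₂ , refl , refl , refl = M₂ ++ M₁ , sym (map-++ f M₂ M₁) , M₁ , M₂ , refl , refl

rotation-∈ : {L R : List A} {x : A} → Rotation L R → x ∈ R → x ∈ L
rotation-∈ (X , Y , refl , refl) x∈ with ∈-++⁻ Y x∈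
... | inj₁ x∈Y = ∈-++⁺ʳ X x∈Y
... | inj₂ x∈X = ∈-++⁺ˡ x∈X

⊆-++⁻ : (P Q : List A) {M : List A} → M ⊆ P ++ Q →
        ∃₂ λ M₁ M₂ → M ≡ M₁ ++ M₂ × M₁ ⊆ P × M₂ ⊆ Q
⊆-++⁻ []      Q M⊆ = [] , _ , refl , [] , M⊆
⊆-++⁻ (x ∷ P) Q (.x ∷ʳ M⊆) with M₁ , M₂ , refl , M₁⊆ , M₂⊆ ← ⊆-++⁻ P Q M⊆ =
  M₁ , M₂ , refl , x ∷ʳ M₁⊆ , M₂⊆
⊆-++⁻ (x ∷ P) Q (refl ∷ M⊆) with M₁ , M₂ , refl , M₁⊆ , M₂⊆ ← ⊆-++⁻ P Q M⊆ =
  x ∷ M₁ , M₂ , refl , refl ∷ M₁⊆ , M₂⊆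

++-⊆⁻ : (M₁ M₂ : List A) {R : List A} → M₁ ++ M₂ ⊆ R →
        ∃₂ λ R₁ R₂ → R ≡ R₁ ++ R₂ × M₁ ⊆ R₁ × M₂ ⊆ R₂
++-⊆⁻ []       M₂ {R} M⊆ = [] , R , refl , [] , M⊆
++-⊆⁻ (x ∷ M₁) M₂ (y ∷ʳ M⊆) with R₁ , R₂ , refl , M₁⊆ , M₂⊆ ← ++-⊆⁻ (x ∷ M₁) M₂ M⊆ =
  y ∷ R₁ , R₂ , refl , y ∷ʳ M₁⊆ , M₂⊆
++-⊆⁻ (x ∷ M₁) M₂ (refl ∷ M⊆) with R₁ , R₂ , refl , M₁⊆ , M₂⊆ ← ++-⊆⁻ M₁ M₂ M⊆ =
  x ∷ R₁ , R₂ , refl , refl ∷ M₁⊆ , M₂⊆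

⊆-map⁻ : (f : A → B) {N : List B} (R : List A) → N ⊆ map f R →
         ∃ λ N₀ → N ≡ map f N₀ × N₀ ⊆ R
⊆-map⁻ f []      [] = [] , refl , []
⊆-map⁻ f (x ∷ R) (.(f x) ∷ʳ N⊆) with N₀ , refl , N₀⊆ ← ⊆-map⁻ f R N⊆ = N₀ , refl , x ∷ʳ N₀⊆
⊆-map⁻ f (x ∷ R) (refl ∷ N⊆)    with N₀ , refl , N₀⊆ ← ⊆-map⁻ f R N⊆ = x ∷ N₀ , refl , refl ∷ N₀⊆

map-≡-[] : (f : A → B) (M : List A) → map f M ≡ [] → M ≡ []
map-≡-[] f [] _ = refl

Fin-≢[] : {L : List A} → Fin (length L) → L ≢ []
Fin-≢[] {L = []} ()

map-≢[] : (f : A → B) {M : List A} → M ≢ [] → map f M ≢ []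
map-≢[] f {[]}    M≢[] _ = M≢[] refl

++-∷-≢[] : (X : List A) {y : A} {Y : List A} → X ++ y ∷ Y ≢ []
++-∷-≢[] []      ()
++-∷-≢[] (_ ∷ _) ()

drop-length-++ : (X Y : List A) → drop (length X) (X ++ Y) ≡ Y
drop-length-++ []      Y = refl
drop-length-++ (x ∷ X) Y = drop-length-++ X Y

take-length-++ : (X Y : List A) → take (length X) (X ++ Y) ≡ X
take-length-++ []      Y = refl
take-length-++ (x ∷ X) Y = cong (x ∷_) (take-length-++ X Y)

⊆-take-drop⁻ : (k : ℕ) {M R : List A} → M ⊆ R →
               ∃₂ λ Q Q′ → M ≡ Q ++ Q′ × Q ⊆ take k R × Q′ ⊆ drop k R
⊆-take-drop⁻ k {R = R} M⊆ = ⊆-++⁻ (take k R) (drop k R) (subst (_ ⊆_) (sym (take++drop≡id k R)) M⊆)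

CyclicSublist : List A → List A → Set
CyclicSublist M L = ∃ λ R → Rotation L R × M ⊆ R

cyclicSublist-recut : {M L R : List A} → CyclicSublist M L → Rotation L R →
                      ∃ λ M′ → Rotation M M′ × M′ ⊆ R
cyclicSublist-recut (R₀ , L↻R₀ , M⊆) L↻R with rotation-trans (rotation-sym L↻R₀) L↻R
... | X , Y , refl , refl with M₁ , M₂ , refl , M₁⊆ , M₂⊆ ← ⊆-++⁻ X Y M⊆ =
  M₂ ++ M₁ , (M₁ , M₂ , refl , refl) , Sublist.++⁺ M₂⊆ M₁⊆

cyclicSublist-trans : {N M L : List A} → CyclicSublist N M → CyclicSublist M L → CyclicSublist N L
cyclicSublist-trans (R₁ , (X , Y , refl , refl) , N⊆) (R , L↻R , M⊆)
  with R₁′ , R₂′ , refl , X⊆ , Y⊆ ← ++-⊆⁻ X Y M⊆ =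
  R₂′ ++ R₁′ , rotation-trans L↻R (R₁′ , R₂′ , refl , refl) , ⊆-trans N⊆ (Sublist.++⁺ Y⊆ X⊆)

cyclicSublist-∈ : {M L : List A} {x : A} → CyclicSublist M L → x ∈ M → x ∈ L
cyclicSublist-∈ (R , L↻R , M⊆) x∈ = rotation-∈ L↻R (Sublist.Any-resp-⊆ M⊆ x∈)

cyclicSublist-map⁻ : (f : A → B) {N : List B} {M : List A} → CyclicSublist N (map f M) →
                     ∃ λ N₀ → N ≡ map f N₀ × CyclicSublist N₀ M
cyclicSublist-map⁻ f {M = M} (R , fM↻R , N⊆) with R₀ , refl , M↻R₀ ← rotation-map⁻ f M fM↻R
  with N₀ , refl , N₀⊆ ← ⊆-map⁻ f R₀ N⊆ = N₀ , refl , R₀ , M↻R₀ , N₀⊆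

-- Minors

-- L′ arises from L by contracting edges (deleting their labels from the cyclic word) and
-- relabelling by φ; a nonempty cycle is never contracted away entirely.
CycleMinor : (ℕ → ℕ) → Cycle → Cycle → Set
CycleMinor φ L L′ = ∃ λ M → CyclicSublist M L × L′ ≡ map φ M × (M ≡ [] → L ≡ [])

cycleMinor-trans : {φ ψ : ℕ → ℕ} {L L′ L″ : Cycle} →
                   CycleMinor φ L L′ → CycleMinor ψ L′ L″ → CycleMinor (ψ ∘ φ) L L″
cycleMinor-trans {φ} (M , M⊑L , refl , M≢[]) (N , N⊑φM , refl , N≢[])
  with N₀ , refl , N₀⊑M ← cyclicSublist-map⁻ φ N⊑φM =
  N₀ , cyclicSublist-trans N₀⊑M M⊑L , sym (map-∘ N₀) ,
  λ { refl → M≢[] (map-≡-[] φ M (N≢[] refl)) }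

cycleMinor-∈ : {φ : ℕ → ℕ} {L L′ : Cycle} {x : ℕ} → CycleMinor φ L L′ → x ∈ L′ →
               ∃ λ y → y ∈ L × x ≡ φ y
cycleMinor-∈ {φ} (M , M⊑L , refl , _) x∈ with y , y∈M , refl ← ∈-map⁻ φ x∈ =
  y , cyclicSublist-∈ M⊑L y∈M , refl

All-∈ : {P : A → Set} {xs : List A} → (∀ {x} → x ∈ xs → P x) → All P xs
All-∈ {xs = []}     f = []
All-∈ {xs = x ∷ xs} f = f (here refl) ∷ All-∈ (f ∘ there)

cycleMinor-agree : {φ ψ : ℕ → ℕ} {L L′ : Cycle} → (∀ {x} → x ∈ L → ψ x ≡ φ x) →
                   CycleMinor φ L L′ → CycleMinor ψ L L′
cycleMinor-agree ψ≗φ (M , M⊑L , refl , M≢[]) =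
  M , M⊑L , map-cong-local (All-∈ (λ x∈ → sym (ψ≗φ (cyclicSublist-∈ M⊑L x∈)))) , M≢[]

-- The cycles of H are cycle minors of distinct cycles of G (those in kept).
record Minor (φ : ℕ → ℕ) (G H : Cycles) : Set where
  constructor minor
  field
    kept dropped H₀ : Cycles
    partition       : kept ++ dropped ↭ G
    reorder         : H₀ ↭ H
    matching        : Pointwise (CycleMinor φ) kept H₀

Pointwise-↭ʳ : {R : A → B → Set} {S : List A} {H H′ : List B} → Pointwise R S H → H ↭ H′ →
               ∃ λ S′ → S ↭ S′ × Pointwise R S′ H′
Pointwise-↭ʳ {S = S} pw Perm.refl = S , ↭-refl , pw
Pointwise-↭ʳ (r ∷ pw) (Perm.prep x p) with S′ , q , pw′ ← Pointwise-↭ʳ pw p =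
  _ , Perm.prep _ q , r ∷ pw′
Pointwise-↭ʳ (r₁ ∷ r₂ ∷ pw) (Perm.swap x y p) with S′ , q , pw′ ← Pointwise-↭ʳ pw p =
  _ , Perm.swap _ _ q , r₂ ∷ r₁ ∷ pw′
Pointwise-↭ʳ pw (Perm.trans p₁ p₂) with S₁ , q₁ , pw₁ ← Pointwise-↭ʳ pw p₁
  with S₂ , q₂ , pw₂ ← Pointwise-↭ʳ pw₁ p₂ = S₂ , ↭-trans q₁ q₂ , pw₂

Pointwise-++ʳ⁻ : {R : A → B → Set} {S : List A} (X Y : List B) → Pointwise R S (X ++ Y) →
                 ∃₂ λ S₁ S₂ → S ≡ S₁ ++ S₂ × Pointwise R S₁ X × Pointwise R S₂ Y
Pointwise-++ʳ⁻ []      Y pw       = [] , _ , refl , [] , pw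
Pointwise-++ʳ⁻ (x ∷ X) Y (r ∷ pw) with S₁ , S₂ , refl , pw₁ , pw₂ ← Pointwise-++ʳ⁻ X Y pw =
  _ ∷ S₁ , S₂ , refl , r ∷ pw₁ , pw₂

Pointwise-∈ʳ : {R : A → B → Set} {S : List A} {H : List B} {y : B} → Pointwise R S H → y ∈ H →
               ∃ λ x → x ∈ S × R x y
Pointwise-∈ʳ (r ∷ pw) (here refl) = _ , here refl , r
Pointwise-∈ʳ (r ∷ pw) (there y∈) with x , x∈ , r′ ← Pointwise-∈ʳ pw y∈ = x , there x∈ , r′

Pointwise-++-∷ˡ⁻ : {R : A → B → Set} (xs ys : List A) {x : A} {H : List B} →
                   Pointwise R (xs ++ x ∷ ys) H →
                   ∃₂ λ Hx y → ∃ λ Hy → H ≡ Hx ++ y ∷ Hy × Pointwise R xs Hx × R x y × Pointwise R ys Hy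
Pointwise-++-∷ˡ⁻ []       ys (r ∷ pw) = [] , _ , _ , refl , [] , r , pw
Pointwise-++-∷ˡ⁻ (x ∷ xs) ys (r ∷ pw) with Hx , y , Hy , refl , pwx , r′ , pwy ← Pointwise-++-∷ˡ⁻ xs ys pw =
  _ ∷ Hx , y , Hy , refl , r ∷ pwx , r′ , pwy

Pointwise-++-∷ʳ⁻ : {R : A → B → Set} (xs ys : List B) {X : B} {S : List A} →
                   Pointwise R S (xs ++ X ∷ ys) →
                   ∃₂ λ Sx L → ∃ λ Sy → S ≡ Sx ++ L ∷ Sy × Pointwise R Sx xs × R L X × Pointwise R Sy ys
Pointwise-++-∷ʳ⁻ []       ys (r ∷ pw) = [] , _ , _ , refl , [] , r , pw
Pointwise-++-∷ʳ⁻ (x ∷ xs) ys (r ∷ pw) with Sx , L , Sy , refl , pwx , r′ , pwy ← Pointwise-++-∷ʳ⁻ xs ys pw =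
  _ ∷ Sx , L , Sy , refl , r ∷ pwx , r′ , pwy

⊆⇒↭-complement : {X Y : List A} → X ⊆ Y → ∃ λ Z → Y ↭ X ++ Z
⊆⇒↭-complement []          = [] , ↭-refl
⊆⇒↭-complement {X = X} (y ∷ʳ X⊆) with Z , p ← ⊆⇒↭-complement X⊆ =
  y ∷ Z , ↭-trans (Perm.prep y p) (↭-sym (shift y X Z))
⊆⇒↭-complement (refl ∷ X⊆) with Z , p ← ⊆⇒↭-complement X⊆ = Z , Perm.prep _ p

regroup : (S₁ S₂ T : Cycles) {S G : Cycles} → S ↭ S₁ ++ S₂ → S ++ T ↭ G → S₁ ++ S₂ ++ T ↭ G
regroup S₁ S₂ T p q = ↭-trans (↭-reflexive (sym (++-assoc S₁ S₂ T))) (↭-trans (++⁺ʳ T (↭-sym p)) q)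

module _ {φ : ℕ → ℕ} where

  Minor-[] : (G : Cycles) → Minor φ G []
  Minor-[] G = minor [] G [] ↭-refl ↭-refl []

  Minor-∷ : {G H : Cycles} {L L′ : Cycle} → CycleMinor φ L L′ → Minor φ G H → Minor φ (L ∷ G) (L′ ∷ H)
  Minor-∷ c (minor S T H₀ pST pH pw) = minor (_ ∷ S) T (_ ∷ H₀) (Perm.prep _ pST) (Perm.prep _ pH) (c ∷ pw)

  Minor-↭ˡ : {G G′ H : Cycles} → G ↭ G′ → Minor φ G H → Minor φ G′ H
  Minor-↭ˡ p (minor S T H₀ pST pH pw) = minor S T H₀ (↭-trans pST p) pH pw

  Minor-↭ʳ : {G H H′ : Cycles} → H ↭ H′ → Minor φ G H → Minor φ G H′
  Minor-↭ʳ p (minor S T H₀ pST pH pw) = minor S T H₀ pST (↭-trans pH p) pw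

  Minor-⊆ʳ : {G H H′ : Cycles} → H′ ⊆ H → Minor φ G H → Minor φ G H′
  Minor-⊆ʳ {H′ = H′} H′⊆ (minor S T H₀ pST pH pw)
    with Hc , q ← ⊆⇒↭-complement H′⊆
    with S′ , q′ , pw′ ← Pointwise-↭ʳ pw (↭-trans pH q)
    with S₁ , S₂ , refl , pw₁ , _ ← Pointwise-++ʳ⁻ H′ Hc pw′ =
    minor S₁ (S₂ ++ T) H′ (regroup S₁ S₂ T q′ pST) ↭-refl pw₁

  Minor-labels : {G H : Cycles} → Minor φ G H → ∀ {x} → x ∈ labels H → ∃ λ y → y ∈ labels G × x ≡ φ y
  Minor-labels {H = H} (minor S T H₀ pST pH pw) x∈
    with L′ , x∈L′ , L′∈H ← ∈-concat⁻′ H x∈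
    with L , L∈S , c ← Pointwise-∈ʳ pw (∈-resp-↭ (↭-sym pH) L′∈H)
    with y , y∈L , refl ← cycleMinor-∈ c x∈L′ =
    y , ∈-concat⁺′ y∈L (∈-resp-↭ pST (∈-++⁺ˡ L∈S)) , refl

  Minor-agree : {ψ : ℕ → ℕ} {G H : Cycles} → (∀ {x} → x ∈ labels G → ψ x ≡ φ x) →
                Minor φ G H → Minor ψ G H
  Minor-agree {ψ} ψ≗φ (minor S T H₀ pST pH pw) =
    minor S T H₀ pST pH (agree (All-∈ λ L∈S {_} x∈L → ψ≗φ (∈-concat⁺′ x∈L (∈-resp-↭ pST (∈-++⁺ˡ L∈S)))) pw)
    where
    agree : ∀ {S H₀} → All (λ L → ∀ {x} → x ∈ L → ψ x ≡ φ x) S →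
            Pointwise (CycleMinor φ) S H₀ → Pointwise (CycleMinor ψ) S H₀
    agree [] [] = []
    agree (a ∷ as) (c ∷ pw) = cycleMinor-agree a c ∷ agree as pw

Minor-trans : {φ ψ : ℕ → ℕ} {G H K : Cycles} → Minor φ G H → Minor ψ H K → Minor (ψ ∘ φ) G K
Minor-trans (minor S T H₀ pST pH pw) (minor S′ T′ K₀ pST′ pK pw′)
  with S₁ , q , pw₁ ← Pointwise-↭ʳ pw (↭-trans pH (↭-sym pST′))
  with Sa , Sb , refl , pwa , _ ← Pointwise-++ʳ⁻ S′ T′ pw₁ =
  minor Sa (Sb ++ T) K₀ (regroup Sa Sb T q pST) pK (Pointwise.transitive cycleMinor-trans pwa pw′)

∈-++-∷⁻ : {x y : A} (X Y : List A) → y ∈ X ++ x ∷ Y → y ≢ x → y ∈ X ++ Y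
∈-++-∷⁻ X Y y∈ y≢x with ∈-++⁻ X y∈
... | inj₁ y∈X         = ∈-++⁺ˡ y∈X
... | inj₂ (here y≡x)  = ⊥-elim (y≢x y≡x)
... | inj₂ (there y∈Y) = ∈-++⁺ʳ X y∈Y

unique⇒length≤ : {xs ys : List A} → Unique xs → (∀ {x} → x ∈ xs → x ∈ ys) → length xs ≤ length ys
unique⇒length≤ {xs = []}     _            _   = z≤n
unique⇒length≤ {xs = x ∷ xs} (x∉xs ∷ xs!) xs⊆ with X , Y , refl ← ∈-∃++ (xs⊆ (here refl)) =
  ≤-trans (s≤s (unique⇒length≤ xs! xs⊆X++Y)) (≤-reflexive (sym (length-++-sucʳ X x Y)))
  where
  xs⊆X++Y : ∀ {y} → y ∈ xs → y ∈ X ++ Y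
  xs⊆X++Y y∈ = ∈-++-∷⁻ X Y (xs⊆ (there y∈)) (λ y≡x → All.lookup x∉xs y∈ (sym y≡x))

Minor-value : {φ : ℕ → ℕ} {G H : Cycles} → Minor φ G H → value H ≤ value G
Minor-value {φ} {G} {H} m =
  ≤-trans (unique⇒length≤ (deduplicate-! (labels H)) labelsH⊆)
          (≤-reflexive (length-map φ (deduplicate _≟_ (labels G))))
  where
  labelsH⊆ : ∀ {x} → x ∈ deduplicate _≟_ (labels H) → x ∈ map φ (deduplicate _≟_ (labels G))
  labelsH⊆ x∈ with y , y∈G , refl ← Minor-labels m (∈-deduplicate⁻ _≟_ (labels H) x∈) =
    ∈-map⁺ φ (∈-deduplicate⁺ _≟_ y∈G)

removeAt : (D : Cycles) → Fin (length D) → Cycles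
removeAt D c = dropIdx D (λ i → does (i Fin.≟ c))

removeAt₂ : (D : Cycles) → Fin (length D) → Fin (length D) → Cycles
removeAt₂ D c c′ = dropIdx D (λ i → does (i Fin.≟ c) ∨ does (i Fin.≟ c′))

dropIdx-none : (D : Cycles) → dropIdx D (λ _ → false) ≡ D
dropIdx-none []      = refl
dropIdx-none (x ∷ D) = cong (x ∷_) (dropIdx-none D)

dropIdx-cong : (D : Cycles) {f g : Fin (length D) → Bool} → (∀ i → f i ≡ g i) → dropIdx D f ≡ dropIdx D g
dropIdx-cong []      f≗g = refl
dropIdx-cong (x ∷ D) {f} {g} f≗g rewrite f≗g Fin.zero with g Fin.zero
... | true  = dropIdx-cong D (λ i → f≗g (Fin.suc i))
... | false = cong (x ∷_) (dropIdx-cong D (λ i → f≗g (Fin.suc i)))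

≟-sym : {n : ℕ} (a b : Fin n) → does (b Fin.≟ a) ≡ does (a Fin.≟ b)
≟-sym Fin.zero    Fin.zero    = refl
≟-sym Fin.zero    (Fin.suc b) = refl
≟-sym (Fin.suc a) Fin.zero    = refl
≟-sym (Fin.suc a) (Fin.suc b) = ≟-sym a b

removeAt₂-sym : (D : Cycles) (c c′ : Fin (length D)) → removeAt₂ D c′ c ≡ removeAt₂ D c c′
removeAt₂-sym D c c′ = dropIdx-cong D (λ i → ∨-comm (does (i Fin.≟ c′)) (does (i Fin.≟ c)))

lookup-↭ : (D : Cycles) (c : Fin (length D)) → D ↭ lookup D c ∷ removeAt D c
lookup-↭ (x ∷ D) Fin.zero    rewrite dropIdx-none D = ↭-refl
lookup-↭ (x ∷ D) (Fin.suc c) = ↭-trans (Perm.prep x (lookup-↭ D c)) (Perm.swap x _ ↭-refl)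

lookup₂-↭ : (D : Cycles) (c c′ : Fin (length D)) → does (c Fin.≟ c′) ≡ false →
            D ↭ lookup D c ∷ lookup D c′ ∷ removeAt₂ D c c′
lookup₂-↭ (x ∷ D) Fin.zero    Fin.zero     ()
lookup₂-↭ (x ∷ D) Fin.zero    (Fin.suc c′) _ = Perm.prep x (lookup-↭ D c′)
lookup₂-↭ (x ∷ D) (Fin.suc c) Fin.zero     _
  rewrite dropIdx-cong D (λ i → ∨-identityʳ (does (i Fin.≟ c))) =
  ↭-trans (Perm.prep x (lookup-↭ D c)) (Perm.swap x _ ↭-refl)
lookup₂-↭ (x ∷ D) (Fin.suc c) (Fin.suc c′) c≢c′ =
  ↭-trans (Perm.prep x (lookup₂-↭ D c c′ c≢c′))
          (↭-trans (Perm.swap x _ ↭-refl) (Perm.prep _ (Perm.swap x _ ↭-refl)))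

Index : Cycles → Cycle → Cycles → Set
Index D x Y = ∃ λ (c : Fin (length D)) → lookup D c ≡ x × removeAt D c ≡ Y

Index₂ : Cycles → Cycle → Cycle → Cycles → Set
Index₂ D x y Y = ∃₂ λ (c c′ : Fin (length D)) → does (c Fin.≟ c′) ≡ false ×
                 lookup D c ≡ x × lookup D c′ ≡ y × removeAt₂ D c c′ ≡ Y

index-++ : (A B : Cycles) (x : Cycle) → Index (A ++ x ∷ B) x (A ++ B)
index-++ []      B x = Fin.zero , refl , dropIdx-none B
index-++ (a ∷ A) B x with c , eq₁ , eq₂ ← index-++ A B x = Fin.suc c , eq₁ , cong (a ∷_) eq₂

index₂-++ : (A B C : Cycles) (x y : Cycle) → Index₂ (A ++ x ∷ B ++ y ∷ C) x y (A ++ B ++ C)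
index₂-++ []      B C x y with c , eq₁ , eq₂ ← index-++ B C y = Fin.zero , Fin.suc c , refl , refl , eq₁ , eq₂
index₂-++ (a ∷ A) B C x y with c , c′ , c≢c′ , eq₁ , eq₂ , eq₃ ← index₂-++ A B C x y =
  Fin.suc c , Fin.suc c′ , c≢c′ , eq₁ , eq₂ , cong (a ∷_) eq₃

index₂-swap : {D : Cycles} {x y : Cycle} {Y : Cycles} → Index₂ D y x Y → Index₂ D x y Y
index₂-swap {D} (c , c′ , c≢c′ , eq₁ , eq₂ , eq₃) =
  c′ , c , trans (≟-sym c c′) c≢c′ , eq₂ , eq₁ , trans (removeAt₂-sym D c c′) eq₃

↭-∷⇒index : (D : Cycles) {x : Cycle} {Y : Cycles} → D ↭ x ∷ Y →
            ∃ λ c → lookup D c ≡ x × removeAt D c ↭ Y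
↭-∷⇒index D {x} p with A , B , refl ← ∈-∃++ (∈-resp-↭ (↭-sym p) (here refl))
  with c , eq₁ , eq₂ ← index-++ A B x = c , eq₁ , ↭-trans (↭-reflexive eq₂) (drop-mid A [] p)

Index₂↭ : Cycles → Cycle → Cycle → Cycles → Set
Index₂↭ D x y Y = ∃₂ λ (c c′ : Fin (length D)) → does (c Fin.≟ c′) ≡ false ×
                  lookup D c ≡ x × lookup D c′ ≡ y × removeAt₂ D c c′ ↭ Y

↭-∷∷⇒index₂ : (D : Cycles) {x y : Cycle} {Y : Cycles} → D ↭ x ∷ y ∷ Y → Index₂↭ D x y Y
↭-∷∷⇒index₂ D {x} {y} {Y} p with A , B , refl ← ∈-∃++ (∈-resp-↭ (↭-sym p) (here refl))
  with ∈-++⁻ A (∈-resp-↭ (↭-sym (drop-mid A [] p)) (here refl))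
... | inj₂ y∈B with B₁ , B₂ , refl ← ∈-∃++ y∈B
  with c , c′ , c≢c′ , eq₁ , eq₂ , eq₃ ← index₂-++ A B₁ B₂ x y =
  c , c′ , c≢c′ , eq₁ , eq₂ , ↭-trans (↭-reflexive (trans eq₃ (sym (++-assoc A B₁ B₂)))) rest
  where
  rest : (A ++ B₁) ++ B₂ ↭ Y
  rest = drop-mid (A ++ B₁) [] (↭-trans (↭-reflexive (++-assoc A B₁ (y ∷ B₂))) (drop-mid A [] p))
... | inj₁ y∈A with A₁ , A₂ , refl ← ∈-∃++ y∈A =
  subst (λ D → Index₂↭ D x y Y) (sym (++-assoc A₁ (y ∷ A₂) (x ∷ B))) index₂
  where
  rest : A₁ ++ y ∷ A₂ ++ B ↭ y ∷ Y
  rest = ↭-trans (↭-reflexive (sym (++-assoc A₁ (y ∷ A₂) B))) (drop-mid (A₁ ++ y ∷ A₂) [] p)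
  index₂ : Index₂↭ (A₁ ++ y ∷ A₂ ++ x ∷ B) x y Y
  index₂ with c , c′ , c≢c′ , eq₁ , eq₂ , eq₃ ← index₂-swap {A₁ ++ y ∷ A₂ ++ x ∷ B} (index₂-++ A₁ A₂ B y x) =
    c , c′ , c≢c′ , eq₁ , eq₂ , ↭-trans (↭-reflexive eq₃) (drop-mid A₁ [] rest)

rot-length-++ : (X Y : Cycle) → rot (length X) (X ++ Y) ≡ Y ++ X
rot-length-++ X Y = cong₂ _++_ (drop-length-++ X Y) (take-length-++ X Y)

rotation-length : {L R : List A} → Rotation L R → length L ≡ length R
rotation-length (X , Y , refl , refl) =
  trans (length-++ X) (trans (+-comm (length X) (length Y)) (sym (length-++ Y)))

rot-to-suffix : (X : Cycle) (y : ℕ) (Y : Cycle) →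
                ∃ λ (p : Fin (length (X ++ y ∷ Y))) → rot (toℕ p) (X ++ y ∷ Y) ≡ y ∷ Y ++ X
rot-to-suffix X y Y =
  fromℕ< |X|<|L| , trans (cong (λ k → rot k (X ++ y ∷ Y)) (toℕ-fromℕ< |X|<|L|)) (rot-length-++ X (y ∷ Y))
  where
  |X|<|L| : length X < length (X ++ y ∷ Y)
  |X|<|L| = subst (length X <_) (sym (length-++ X)) (m<m+n (length X) (s≤s z≤n))

rotation⇒rot : (L : Cycle) {R : Cycle} → Rotation L R → L ≢ [] →
               ∃ λ (p : Fin (length L)) → rot (toℕ p) L ≡ R
rotation⇒rot L (X     , y ∷ Y , refl , refl) _   = rot-to-suffix X y Y
rotation⇒rot L ([]    , []    , refl , refl) L≢[] = ⊥-elim (L≢[] refl)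
rotation⇒rot L (x ∷ X , []    , refl , refl) _
  with p , eq ← rot-to-suffix [] x (X ++ []) = p , trans eq (trans (++-identityʳ _) (++-identityʳ _))

-- q = (p + k) mod m is k steps after p on a cycle of length m; the test p ≤ᵇ q inside arcLen
-- is definitionally does (p ≤? q), which dec-true/dec-false evaluate.
arcLen-target : (m p k : ℕ) → p < m → k < m → ∃ λ (q : Fin m) → arcLen m p (toℕ q) ≡ k
arcLen-target m p k p<m k<m with p + k <? m
... | yes p+k<m = fromℕ< p+k<m , (begin
  arcLen m p (toℕ (fromℕ< p+k<m)) ≡⟨ cong (arcLen m p) (toℕ-fromℕ< p+k<m) ⟩
  arcLen m p (p + k)               ≡⟨ cong (λ b → if b then p + k ∸ p else m ∸ (p ∸ (p + k)))
                                           (dec-true (p ≤? p + k) (m≤m+n p k)) ⟩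
  p + k ∸ p                        ≡⟨ m+n∸m≡n p k ⟩
  k                                ∎)
... | no p+k≮m = fromℕ< q<m , (begin
  arcLen m p (toℕ (fromℕ< q<m))   ≡⟨ cong (arcLen m p) (toℕ-fromℕ< q<m) ⟩
  arcLen m p q                     ≡⟨ cong (λ b → if b then q ∸ p else m ∸ (p ∸ q))
                                           (dec-false (p ≤? q) (<⇒≱ q<p)) ⟩
  m ∸ (p ∸ q)                      ≡⟨ cong (λ n → m ∸ (p ∸ n)) q≡p∸[m∸k] ⟩
  m ∸ (p ∸ (p ∸ (m ∸ k)))          ≡⟨ cong (m ∸_) (m∸[m∸n]≡n m∸k≤p) ⟩
  m ∸ (m ∸ k)                      ≡⟨ m∸[m∸n]≡n (<⇒≤ k<m) ⟩
  k                                ∎)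
  where
  q = p + k ∸ m
  m≤p+k : m ≤ p + k
  m≤p+k = ≮⇒≥ p+k≮m
  q<p : q < p
  q<p = +-cancelʳ-< m q p (subst (_< p + m) (sym (m∸n+n≡m m≤p+k)) (+-monoʳ-< p k<m))
  q<m : q < m
  q<m = <-trans q<p p<m
  q≡p∸[m∸k] : q ≡ p ∸ (m ∸ k)
  q≡p∸[m∸k] = begin
    p + k ∸ m               ≡⟨ cong (p + k ∸_) (sym (m+[n∸m]≡n (<⇒≤ k<m))) ⟩
    p + k ∸ (k + (m ∸ k))   ≡⟨ sym (∸-+-assoc (p + k) k (m ∸ k)) ⟩
    p + k ∸ k ∸ (m ∸ k)     ≡⟨ cong (_∸ (m ∸ k)) (m+n∸n≡m p k) ⟩
    p ∸ (m ∸ k)             ∎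
  m∸k≤p : m ∸ k ≤ p
  m∸k≤p = ≤-trans (∸-monoˡ-≤ k m≤p+k) (≤-reflexive (m+n∸n≡m p k))

rotation-≡[] : {L R : List A} → Rotation L R → R ≡ [] → L ≡ []
rotation-≡[] (X , Y , refl , refl) YX≡[] rewrite ++-conicalˡ Y X YX≡[] | ++-conicalʳ Y X YX≡[] = refl

rotation-≢[] : {L R : List A} → Rotation L R → L ≢ [] → R ≢ []
rotation-≢[] L↻R L≢[] = L≢[] ∘ rotation-≡[] L↻R

length-prefix< : {L : Cycle} (Q Q′ : Cycle) → Rotation L (Q ++ Q′) → Q′ ≢ [] → length Q < length L
length-prefix< Q []       _  Q′≢[] = ⊥-elim (Q′≢[] refl)
length-prefix< Q (x ∷ Q′) L↻ _     =
  subst (length Q <_) (sym (trans (rotation-length L↻) (length-++ Q))) (m<m+n (length Q) (s≤s z≤n))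

rotation⇒arc : (L Q Q′ : Cycle) → Rotation L (Q ++ Q′) → Q′ ≢ [] →
               ∃₂ λ (p q : Fin (length L)) →
                  rot (toℕ p) L ≡ Q ++ Q′ × arcLen (length L) (toℕ p) (toℕ q) ≡ length Q
rotation⇒arc L Q Q′ L↻ Q′≢[]
  with p , rot≡ ← rotation⇒rot L L↻ (rotation-≢[] (rotation-sym L↻) (Q′≢[] ∘ ++-conicalʳ Q Q′))
  with q , arc≡ ← arcLen-target (length L) (toℕ p) (length Q) (toℕ<n p) (length-prefix< Q Q′ L↻ Q′≢[]) =
  p , q , rot≡ , arc≡

-- Pulling Cutter's moves back along a minor

StateMinor : State → State → Set
StateMinor γ α = ∃ λ φ → ctr α ≤ ctr γ × Minor φ (cyc γ) (cyc α)

stateMinor-trans : {γ α β : State} → StateMinor γ α → StateMinor α β → StateMinor γ β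
stateMinor-trans (φ , ≤₁ , m₁) (ψ , ≤₂ , m₂) = ψ ∘ φ , ≤-trans ≤₂ ≤₁ , Minor-trans m₁ m₂

PullsBack : (γ α : State) (v w : Vtx (cyc γ)) (v′ w′ : Vtx (cyc α)) → Set
PullsBack γ α v w v′ w′ = ∀ α′ → Move α v′ w′ α′ → ∃ λ γ′ → BasicMove γ v w γ′ × StateMinor γ′ α′

pullsBack-same : (γ α : State) {v w : Vtx (cyc γ)} {v′ w′ : Vtx (cyc α)} {rest rest′ : Cycles}
                 {C₁ C₂ C₁′ C₂′ : Cycle} (φ : ℕ → ℕ) →
                 split (cyc γ) v w ≡ same rest C₁ C₂ → split (cyc α) v′ w′ ≡ same rest′ C₁′ C₂′ →
                 ctr α ≤ ctr γ → Minor φ rest rest′ →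
                 (CycleMinor φ C₁ C₁′ × CycleMinor φ C₂ C₂′) ⊎ (CycleMinor φ C₁ C₂′ × CycleMinor φ C₂ C₁′) →
                 PullsBack γ α v w v′ w′
pullsBack-same ⟨ _ , zero ⟩ α φ eqγ eqα () m c α′ (moveA eq sub refl)
pullsBack-same ⟨ _ , suc g ⟩ α φ eqγ eqα ≤g m c α′ (moveA eq sub refl) with refl ← trans (sym eq) eqα with c
... | inj₁ (c₁ , c₂) = _ , rmoveA eqγ refl , φ , s≤s⁻¹ ≤g , Minor-∷ c₁ (Minor-∷ c₂ (Minor-⊆ʳ sub m))
... | inj₂ (c₁ , c₂) = _ , rmoveA eqγ refl , φ , s≤s⁻¹ ≤g ,
  Minor-↭ˡ (Perm.swap _ _ ↭-refl) (Minor-∷ c₂ (Minor-∷ c₁ (Minor-⊆ʳ sub m)))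
pullsBack-same γ α φ eqγ eqα ≤g m c α′ (moveB eq sub ≤g′) with refl ← trans (sym eq) eqα with c
... | inj₁ (c₁ , _) = _ , rmoveB eqγ , φ , ≤-trans ≤g′ ≤g , Minor-∷ c₁ (Minor-⊆ʳ sub m)
... | inj₂ (_ , c₂) = _ , rmoveC eqγ , φ , ≤-trans ≤g′ ≤g , Minor-∷ c₂ (Minor-⊆ʳ sub m)
pullsBack-same γ α φ eqγ eqα ≤g m c α′ (moveC eq sub ≤g′) with refl ← trans (sym eq) eqα with c
... | inj₁ (_ , c₂) = _ , rmoveC eqγ , φ , ≤-trans ≤g′ ≤g , Minor-∷ c₂ (Minor-⊆ʳ sub m)
... | inj₂ (c₁ , _) = _ , rmoveB eqγ , φ , ≤-trans ≤g′ ≤g , Minor-∷ c₁ (Minor-⊆ʳ sub m)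
pullsBack-same γ α φ eqγ eqα ≤g m c α′ (moveD eq) with () ← trans (sym eq) eqα

pullsBack-diff : (γ α : State) {v w : Vtx (cyc γ)} {v′ w′ : Vtx (cyc α)} {rest rest′ : Cycles}
                 {C C′ : Cycle} (φ : ℕ → ℕ) →
                 split (cyc γ) v w ≡ diff rest C → split (cyc α) v′ w′ ≡ diff rest′ C′ →
                 ctr α ≤ ctr γ → Minor φ rest rest′ → CycleMinor φ C C′ → PullsBack γ α v w v′ w′
pullsBack-diff γ α φ eqγ eqα ≤g m c α′ (moveA eq _ _) with () ← trans (sym eq) eqα
pullsBack-diff γ α φ eqγ eqα ≤g m c α′ (moveB eq _ _) with () ← trans (sym eq) eqα
pullsBack-diff γ α φ eqγ eqα ≤g m c α′ (moveC eq _ _) with () ← trans (sym eq) eqα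
pullsBack-diff γ α φ eqγ eqα ≤g m c α′ (moveD eq) with refl ← trans (sym eq) eqα =
  _ , rmoveD eqγ , φ , ≤g , Minor-∷ c m

data Located (φ : ℕ → ℕ) (L : Cycle) (rest H : Cycles) : Set where
  kept    : (L′ : Cycle) (H′ : Cycles) → CycleMinor φ L L′ → H ↭ L′ ∷ H′ → Minor φ rest H′ →
            Located φ L rest H
  dropped : Minor φ rest H → Located φ L rest H

locate : {φ : ℕ → ℕ} {G H rest : Cycles} {L : Cycle} → Minor φ G H → G ↭ L ∷ rest → Located φ L rest H
locate {rest = rest} {L} (minor S T H₀ pST pH pw) p
  with ∈-++⁻ S (∈-resp-↭ (↭-sym (↭-trans pST p)) (here refl))
... | inj₁ L∈S with A , B , refl ← ∈-∃++ L∈S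
  with HA , L′ , HB , refl , pwA , c , pwB ← Pointwise-++-∷ˡ⁻ A B pw =
  kept L′ (HA ++ HB) c (↭-trans (↭-sym pH) (shift L′ HA HB))
       (minor (A ++ B) T (HA ++ HB) partition ↭-refl (Pointwise.++⁺ pwA pwB))
  where
  partition : (A ++ B) ++ T ↭ rest
  partition = ↭-trans (↭-reflexive (++-assoc A B T))
    (drop-mid A [] (↭-trans (↭-reflexive (sym (++-assoc A (L ∷ B) T))) (↭-trans pST p)))
... | inj₂ L∈T with A , B , refl ← ∈-∃++ L∈T = dropped (minor S (A ++ B) H₀ partition pH pw)
  where
  partition : S ++ A ++ B ↭ rest
  partition = ↭-trans (↭-reflexive (sym (++-assoc S A B)))
    (drop-mid (S ++ A) [] (↭-trans (↭-reflexive (++-assoc S A (L ∷ B))) (↭-trans pST p)))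

cycleMinor-⊆ : {φ : ℕ → ℕ} {M L L′ : Cycle} → M ⊆ L → L′ ≡ map φ M → M ≢ [] → CycleMinor φ L L′
cycleMinor-⊆ {L = L} M⊆ eq M≢[] = _ , (L , rotation-refl L , M⊆) , eq , ⊥-elim ∘ M≢[]

cycleMinor-from : {φ : ℕ → ℕ} {L L′ : Cycle} → CycleMinor φ L L′ → (p : Fin (length L)) →
                  ∃ λ M → M ⊆ rot (toℕ p) L × Rotation L′ (map φ M) × M ≢ []
cycleMinor-from {φ} {L} (M , M⊑L , refl , M≡[]⇒L≡[]) p
  with M′ , M↻M′ , M′⊆ ← cyclicSublist-recut M⊑L (rot-rotation (toℕ p) L) =
  M′ , M′⊆ , rotation-map φ M↻M′ , rotation-≢[] M↻M′ (Fin-≢[] p ∘ M≡[]⇒L≡[])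

vertex-image : {φ : ℕ → ℕ} {L L′ : Cycle} → CycleMinor φ L L′ → (p : Fin (length L)) →
               ∃₂ λ (p′ : Fin (length L′)) M → M ⊆ rot (toℕ p) L × rot (toℕ p′) L′ ≡ map φ M
vertex-image {φ} {L} {L′} c p
  with M , M⊆ , L′↻ , M≢[] ← cycleMinor-from c p
  with p′ , rot≡ ← rotation⇒rot L′ L′↻ (rotation-≢[] (rotation-sym L′↻) (map-≢[] φ M≢[])) =
  p′ , M , M⊆ , rot≡

relabel : (ℕ → ℕ) → ℕ → ℕ → ℕ → ℕ
relabel φ a b x = if does (x ≟ a) then b else φ x

relabel-≡ : (φ : ℕ → ℕ) (a b : ℕ) → relabel φ a b a ≡ b
relabel-≡ φ a b rewrite dec-true (a ≟ a) refl = refl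

relabel-≢ : (φ : ℕ → ℕ) (a b x : ℕ) → x ≢ a → relabel φ a b x ≡ φ x
relabel-≢ φ a b x x≢a rewrite dec-false (x ≟ a) x≢a = refl

≤-foldr-⊔ : {x : ℕ} (xs : List ℕ) → x ∈ xs → x ≤ foldr _⊔_ 0 xs
≤-foldr-⊔ (y ∷ xs) (here refl) = m≤m⊔n y _
≤-foldr-⊔ (y ∷ xs) (there x∈) = m≤n⇒m≤o⊔n y (≤-foldr-⊔ xs x∈)

fresh-∉ : (G : Cycles) {x : ℕ} → x ∈ labels G → x ≢ fresh G
fresh-∉ G x∈ refl = <-irrefl refl (s≤s (≤-foldr-⊔ (labels G) x∈))

split-real-real-≡ : (G : Cycles) (c : Fin (length G)) (p : Fin (length (lookup G c)))
                    (c′ : Fin (length G)) (q : Fin (length (lookup G c′))) → does (c Fin.≟ c′) ≡ true →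
                    let R = rot (toℕ p) (lookup G c) ; k = arcLen (length (lookup G c)) (toℕ p) (toℕ q) in
                    split G (real c p) (real c′ q) ≡
                      same (removeAt G c) (take k R ++ [ fresh G ]) (drop k R ++ [ fresh G ])
split-real-real-≡ G c p c′ q c≡c′ rewrite c≡c′ = refl

split-real-real-≢ : (G : Cycles) (c : Fin (length G)) (p : Fin (length (lookup G c)))
                    (c′ : Fin (length G)) (q : Fin (length (lookup G c′))) → does (c Fin.≟ c′) ≡ false →
                    split G (real c p) (real c′ q) ≡
                      diff (removeAt₂ G c c′)
                           (rot (toℕ p) (lookup G c) ++ fresh G ∷ rot (toℕ q) (lookup G c′) ++ [ fresh G ])
split-real-real-≢ G c p c′ q c≢c′ rewrite c≢c′ = refl

split-at-rotation : (D : Cycles) (c : Fin (length D)) (Q Q′ : Cycle) →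
                    Rotation (lookup D c) (Q ++ Q′) → Q′ ≢ [] →
                    ∃₂ λ p q → split D (real c p) (real c q) ≡
                               same (removeAt D c) (Q ++ [ fresh D ]) (Q′ ++ [ fresh D ])
split-at-rotation D c Q Q′ L↻ Q′≢[] with p , q , rot≡ , arc≡ ← rotation⇒arc (lookup D c) Q Q′ L↻ Q′≢[] =
  p , q , trans (split-real-real-≡ D c p c q (dec-true (c Fin.≟ c) refl))
                (cong₂ (λ A B → same (removeAt D c) (A ++ [ fresh D ]) (B ++ [ fresh D ]))
                       (trans (cong₂ take arc≡ rot≡) (take-length-++ Q Q′))
                       (trans (cong₂ drop arc≡ rot≡) (drop-length-++ Q Q′)))

module PullBack (γ α : State) (φ : ℕ → ℕ) (ctr≤ : ctr α ≤ ctr γ) (γ≽α : Minor φ (cyc γ) (cyc α)) where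

  G H : Cycles
  G = cyc γ
  H = cyc α

  f f′ : ℕ
  f  = fresh G
  f′ = fresh H

  -- the label of γ's new edges is sent to the label of α's new edges
  ψ : ℕ → ℕ
  ψ = relabel φ f f′

  γ≽ψα : Minor ψ G H
  γ≽ψα = Minor-agree (λ x∈ → relabel-≢ φ f f′ _ (fresh-∉ G x∈)) γ≽α

  map-ψ-++-f : (X Y : Cycle) → map ψ (X ++ f ∷ Y) ≡ map ψ X ++ f′ ∷ map ψ Y
  map-ψ-++-f X Y = trans (map-++ ψ X (f ∷ Y)) (cong (λ z → map ψ X ++ z ∷ map ψ Y) (relabel-≡ φ f f′))

  closed-minor : (P X : Cycle) → X ⊆ P → CycleMinor ψ (P ++ [ f ]) (map ψ X ++ [ f′ ])
  closed-minor P X X⊆ =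
    cycleMinor-⊆ (Sublist.++⁺ X⊆ (refl ∷ [])) (sym (map-ψ-++-f X [])) (++-∷-≢[] X)

  merged-minor : (P P′ X X′ : Cycle) → X ⊆ P → X′ ⊆ P′ →
                 CycleMinor ψ (P ++ f ∷ P′ ++ [ f ]) (map ψ X ++ f′ ∷ map ψ X′ ++ [ f′ ])
  merged-minor P P′ X X′ X⊆ X′⊆ =
    cycleMinor-⊆ (Sublist.++⁺ X⊆ (refl ∷ Sublist.++⁺ X′⊆ (refl ∷ [])))
                 (sym (trans (map-ψ-++-f X (X′ ++ [ f ]))
                             (cong (λ Z → map ψ X ++ f′ ∷ Z) (map-ψ-++-f X′ []))))
                 (++-∷-≢[] X)

  Answer : Vtx G → Vtx G → Set
  Answer v w = ∃₂ λ v′ w′ → PullsBack γ α v w v′ w′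

  dummy-real : (x : Vtx G) (c : Fin (length G)) (q : Fin (length (lookup G c))) →
               split G x (real c q) ≡ diff (removeAt G c) (f ∷ rot (toℕ q) (lookup G c) ++ [ f ]) →
               Answer x (real c q)
  dummy-real x c q eqγ with locate γ≽ψα (lookup-↭ G c)
  ... | dropped m = dummyV , dummyW ,
    pullsBack-diff γ α ψ eqγ refl ctr≤ m (merged-minor [] _ [] [] [] (minimum _))
  ... | kept L′ H′ cm L↭ m with c₁ , refl , H↭ ← ↭-∷⇒index H L↭
    with q₁ , M , M⊆ , rot≡ ← vertex-image cm q = dummyV , real c₁ q₁ ,
    pullsBack-diff γ α ψ eqγ (cong (λ Z → diff _ (f′ ∷ Z ++ [ f′ ])) rot≡) ctr≤
                   (Minor-↭ʳ (↭-sym H↭) m) (merged-minor [] _ [] M [] M⊆)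

  real-dummy : (x : Vtx G) (c : Fin (length G)) (p : Fin (length (lookup G c))) →
               split G (real c p) x ≡ diff (removeAt G c) (rot (toℕ p) (lookup G c) ++ f ∷ [ f ]) →
               Answer (real c p) x
  real-dummy x c p eqγ with locate γ≽ψα (lookup-↭ G c)
  ... | dropped m = dummyV , dummyW ,
    pullsBack-diff γ α ψ eqγ refl ctr≤ m (merged-minor _ [] [] [] (minimum _) [])
  ... | kept L′ H′ cm L↭ m with c₁ , refl , H↭ ← ↭-∷⇒index H L↭
    with p₁ , M , M⊆ , rot≡ ← vertex-image cm p = real c₁ p₁ , dummyV ,
    pullsBack-diff γ α ψ eqγ (cong (λ Z → diff _ (Z ++ f′ ∷ [ f′ ])) rot≡) ctr≤
                   (Minor-↭ʳ (↭-sym H↭) m) (merged-minor _ [] M [] M⊆ [])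

  real-real-≢ : (c : Fin (length G)) (p : Fin (length (lookup G c)))
                (c′ : Fin (length G)) (q : Fin (length (lookup G c′))) → does (c Fin.≟ c′) ≡ false →
                Answer (real c p) (real c′ q)
  real-real-≢ c p c′ q c≢c′ with locate γ≽ψα (lookup₂-↭ G c c′ c≢c′)
  ... | kept L′ H₁ cmL L↭ m₁ with locate m₁ ↭-refl
  ...   | kept K′ H₂ cmK K↭ m₂
    with c₁ , c₂ , c₁≢c₂ , refl , refl , H↭ ← ↭-∷∷⇒index₂ H (↭-trans L↭ (Perm.prep L′ K↭))
    with p₁ , M , M⊆ , rot≡₁ ← vertex-image cmL p
    with q₂ , N , N⊆ , rot≡₂ ← vertex-image cmK q = real c₁ p₁ , real c₂ q₂ ,
    pullsBack-diff γ α ψ (split-real-real-≢ G c p c′ q c≢c′)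
      (trans (split-real-real-≢ H c₁ p₁ c₂ q₂ c₁≢c₂)
             (cong₂ (λ Z W → diff _ (Z ++ f′ ∷ W ++ [ f′ ])) rot≡₁ rot≡₂))
      ctr≤ (Minor-↭ʳ (↭-sym H↭) m₂) (merged-minor _ _ M N M⊆ N⊆)
  ...   | dropped m₂ with c₁ , refl , H↭ ← ↭-∷⇒index H L↭
    with p₁ , M , M⊆ , rot≡ ← vertex-image cmL p = real c₁ p₁ , dummyV ,
    pullsBack-diff γ α ψ (split-real-real-≢ G c p c′ q c≢c′) (cong (λ Z → diff _ (Z ++ f′ ∷ [ f′ ])) rot≡)
      ctr≤ (Minor-↭ʳ (↭-sym H↭) m₂) (merged-minor _ _ M [] M⊆ (minimum _))
  real-real-≢ c p c′ q c≢c′ | dropped m₁ with locate m₁ ↭-refl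
  ...   | kept K′ H₂ cmK K↭ m₂ with c₂ , refl , H↭ ← ↭-∷⇒index H K↭
    with q₂ , N , N⊆ , rot≡ ← vertex-image cmK q = dummyV , real c₂ q₂ ,
    pullsBack-diff γ α ψ (split-real-real-≢ G c p c′ q c≢c′) (cong (λ Z → diff _ (f′ ∷ Z ++ [ f′ ])) rot≡)
      ctr≤ (Minor-↭ʳ (↭-sym H↭) m₂) (merged-minor _ _ [] N (minimum _) N⊆)
  ...   | dropped m₂ = dummyV , dummyW ,
    pullsBack-diff γ α ψ (split-real-real-≢ G c p c′ q c≢c′) refl ctr≤ m₂
      (merged-minor _ _ [] [] (minimum _) (minimum _))

  real-real-≡ : (c : Fin (length G)) (p : Fin (length (lookup G c)))
                (c′ : Fin (length G)) (q : Fin (length (lookup G c′))) → does (c Fin.≟ c′) ≡ true →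
                Answer (real c p) (real c′ q)
  real-real-≡ c p c′ q c≡c′ with locate γ≽ψα (lookup-↭ G c)
  ... | dropped m = dummyV , dummyV ,
    pullsBack-same γ α ψ (split-real-real-≡ G c p c′ q c≡c′) refl ctr≤ m
      (inj₁ (closed-minor _ [] (minimum _) , closed-minor _ [] (minimum _)))
  ... | kept L′ H′ cm L↭ m with c₁ , refl , H↭ ← ↭-∷⇒index H L↭
    with M , M⊆ , L′↻ , M≢[] ← cycleMinor-from cm p
    with Q , Q′ , refl , Q⊆ , Q′⊆ ← ⊆-take-drop⁻ (arcLen (length (lookup G c)) (toℕ p) (toℕ q)) M⊆
    with Q′
  ... | z ∷ Z with p₁ , q₁ , eqα ← split-at-rotation H c₁ (map ψ Q) (map ψ (z ∷ Z))
                                      (subst (Rotation _) (map-++ ψ Q (z ∷ Z)) L′↻) (λ ()) =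
    real c₁ p₁ , real c₁ q₁ ,
    pullsBack-same γ α ψ (split-real-real-≡ G c p c′ q c≡c′) eqα ctr≤ (Minor-↭ʳ (↭-sym H↭) m)
      (inj₁ (closed-minor _ Q Q⊆ , closed-minor _ (z ∷ Z) Q′⊆))
  -- An arc of α's cycle is shorter than the cycle, so an empty Q′ forces the crosswise matching.
  ... | [] with p₁ , q₁ , eqα ← split-at-rotation H c₁ [] (map ψ Q)
                                   (subst (Rotation _) (cong (map ψ) (++-identityʳ Q)) L′↻)
                                   (map-≢[] ψ (M≢[] ∘ trans (++-identityʳ Q))) =
    real c₁ p₁ , real c₁ q₁ ,
    pullsBack-same γ α ψ (split-real-real-≡ G c p c′ q c≡c′) eqα ctr≤ (Minor-↭ʳ (↭-sym H↭) m)
      (inj₂ (closed-minor _ Q Q⊆ , closed-minor _ [] (minimum _)))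

  answer : (v w : Vtx G) → Answer v w
  answer dummyV      dummyV       = dummyV , dummyV ,
    pullsBack-same γ α ψ refl refl ctr≤ γ≽ψα (inj₁ (closed-minor [] [] [] , closed-minor [] [] []))
  answer dummyW      dummyW       = dummyW , dummyW ,
    pullsBack-same γ α ψ refl refl ctr≤ γ≽ψα (inj₁ (closed-minor [] [] [] , closed-minor [] [] []))
  answer dummyV      dummyW       = dummyV , dummyW ,
    pullsBack-diff γ α ψ refl refl ctr≤ γ≽ψα (merged-minor [] [] [] [] [] [])
  answer dummyW      dummyV       = dummyW , dummyV ,
    pullsBack-diff γ α ψ refl refl ctr≤ γ≽ψα (merged-minor [] [] [] [] [] [])
  answer dummyV      (real c q)   = dummy-real dummyV c q refl
  answer dummyW      (real c q)   = dummy-real dummyW c q refl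
  answer (real c p)  dummyV       = real-dummy dummyV c p refl
  answer (real c p)  dummyW       = real-dummy dummyW c p refl
  answer (real c p)  (real c′ q) with does (c Fin.≟ c′) in eq
  ... | true  = real-real-≡ c p c′ q eq
  ... | false = real-real-≢ c p c′ q eq

pull-back : {γ α : State} → StateMinor γ α → (v w : Vtx (cyc γ)) → ∃₂ λ v′ w′ → PullsBack γ α v w v′ w′
pull-back {γ} {α} (φ , ctr≤ , m) = PullBack.answer γ α φ ctr≤ m

-- Reductions of equivalent states are minors

SubCycle : Cycle → Cycle → Set
SubCycle L M = M ⊆ L × (M ≡ [] → L ≡ [])

Contraction : Cycles → Cycles → Set
Contraction G D = ∃ λ S → S ⊆ G × Pointwise SubCycle S D

contraction-refl : (G : Cycles) → Contraction G G
contraction-refl G = G , ⊆-refl , Pointwise.refl (⊆-refl , λ L≡[] → L≡[])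

contraction-step : {G D D′ : Cycles} → Contraction G D → Contract D D′ → Contraction G D′
contraction-step (S , S⊆ , pw) (contrEdge xs ys as b cs as++cs≢[])
  with Sx , L , Sy , refl , pwx , (M⊆ , _) , pwy ← Pointwise-++-∷ʳ⁻ xs ys pw =
  Sx ++ L ∷ Sy , S⊆ ,
  Pointwise.++⁺ pwx ((⊆-trans (Sublist.++⁺ ⊆-refl (b ∷ʳ ⊆-refl)) M⊆ , ⊥-elim ∘ as++cs≢[]) ∷ pwy)
contraction-step (S , S⊆ , pw) (contrLoop xs ys b)
  with Sx , L , Sy , refl , pwx , _ , pwy ← Pointwise-++-∷ʳ⁻ xs ys pw =
  Sx ++ Sy , ⊆-trans (Sublist.++⁺ (⊆-refl {x = Sx}) (L ∷ʳ ⊆-refl)) S⊆ , Pointwise.++⁺ pwx pwy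

contraction-star : {G D D′ : Cycles} → Contraction G D → Star Contract D D′ → Contraction G D′
contraction-star c ε        = c
contraction-star c (s ◅ ss) = contraction-star (contraction-step c s) ss

rot-map : (φ : ℕ → ℕ) (k : ℕ) (M : Cycle) → rot k (map φ M) ≡ map φ (rot k M)
rot-map φ k M = trans (cong₂ _++_ (drop-map k M) (take-map k M)) (sym (map-++ φ (drop k M) (take k M)))

relabelled-rotations : (φ : ℕ → ℕ) {S D E : Cycles} → Pointwise SubCycle S D →
                       Pointwise CycEq (map (map φ) D) E → Pointwise (CycleMinor φ) S E
relabelled-rotations φ [] [] = []
relabelled-rotations φ {L ∷ S} {M ∷ D} ((M⊆ , M≡[]⇒L≡[]) ∷ pw) ((k , refl) ∷ pw′) =
  (rot k M , cyclicSublist-trans (rot k M , rot-rotation k M , ⊆-refl) (L , rotation-refl L , M⊆) ,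
   rot-map φ k M , M≡[]⇒L≡[] ∘ rotation-≡[] (rot-rotation k M)) ∷ relabelled-rotations φ pw pw′

ReductionEquivalent : State → State → Set
ReductionEquivalent γ γ′ = ∃[ ρ ] (Reduction γ ρ × Equivalent ρ γ′)

reductionEquivalent⇒minor : (γ γ′ : State) → ReductionEquivalent γ γ′ → StateMinor γ γ′
reductionEquivalent⇒minor γ γ′ (ρ , (ctr≤ , contractions) , (ctr≡ , φ , _ , E , pwE , E↭))
  with S , S⊆ , pw ← contraction-star (contraction-refl (cyc γ)) contractions
  with T , G↭ ← ⊆⇒↭-complement S⊆ =
  φ , ≤-trans (≤-reflexive (sym ctr≡)) ctr≤ , minor S T E (↭-sym G↭) E↭ (relabelled-rotations φ pw pwE)

-- Minors are decidable

consˡ : A → List A × List A → List A × List A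
consˡ x (X , Y) = x ∷ X , Y

splits : List A → List (List A × List A)
splits []      = ([] , []) ∷ []
splits (x ∷ L) = ([] , x ∷ L) ∷ map (consˡ x) (splits L)

∈-splits⁻ : (L : List A) {X Y : List A} → (X , Y) ∈ splits L → L ≡ X ++ Y
∈-splits⁻ []      (here refl) = refl
∈-splits⁻ (x ∷ L) (here refl) = refl
∈-splits⁻ (x ∷ L) (there XY∈) with (X , Y) , XY∈′ , refl ← ∈-map⁻ (consˡ x) XY∈ =
  cong (x ∷_) (∈-splits⁻ L XY∈′)

∈-splits⁺ : (X Y : List A) → (X , Y) ∈ splits (X ++ Y)
∈-splits⁺ []      []      = here refl
∈-splits⁺ []      (y ∷ Y) = here refl
∈-splits⁺ (x ∷ X) Y       = there (∈-map⁺ (consˡ x) (∈-splits⁺ X Y))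

swapAppend : List A × List A → List A
swapAppend (X , Y) = Y ++ X

rotations : List A → List (List A)
rotations L = map swapAppend (splits L)

∈-rotations⁻ : (L : List A) {R : List A} → R ∈ rotations L → Rotation L R
∈-rotations⁻ L R∈ with (X , Y) , XY∈ , refl ← ∈-map⁻ swapAppend R∈ = X , Y , ∈-splits⁻ L XY∈ , refl

∈-rotations⁺ : {L R : List A} → Rotation L R → R ∈ rotations L
∈-rotations⁺ (X , Y , refl , refl) = ∈-map⁺ swapAppend (∈-splits⁺ X Y)

sublists : List A → List (List A)
sublists []      = [] ∷ []
sublists (x ∷ L) = map (x ∷_) (sublists L) ++ sublists L

∈-sublists⁻ : (L : List A) {M : List A} → M ∈ sublists L → M ⊆ L
∈-sublists⁻ []      (here refl) = []
∈-sublists⁻ (x ∷ L) M∈ with ∈-++⁻ (map (x ∷_) (sublists L)) M∈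
... | inj₁ xM∈ with M , M∈′ , refl ← ∈-map⁻ (x ∷_) xM∈ = refl ∷ ∈-sublists⁻ L M∈′
... | inj₂ M∈′ = x ∷ʳ ∈-sublists⁻ L M∈′

∈-sublists⁺ : {L M : List A} → M ⊆ L → M ∈ sublists L
∈-sublists⁺ []          = here refl
∈-sublists⁺ (y ∷ʳ M⊆)   = ∈-++⁺ʳ _ (∈-sublists⁺ M⊆)
∈-sublists⁺ (refl ∷ M⊆) = ∈-++⁺ˡ (∈-map⁺ (_ ∷_) (∈-sublists⁺ M⊆))

cyclicSublists : List A → List (List A)
cyclicSublists L = concatMap sublists (rotations L)

∈-cyclicSublists⁻ : (L : List A) {M : List A} → M ∈ cyclicSublists L → CyclicSublist M L
∈-cyclicSublists⁻ L M∈ with R , R∈ , M∈′ ← find (∈-concatMap⁻ sublists {xs = rotations L} M∈) =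
  R , ∈-rotations⁻ L R∈ , ∈-sublists⁻ R M∈′

∈-cyclicSublists⁺ : {L M : List A} → CyclicSublist M L → M ∈ cyclicSublists L
∈-cyclicSublists⁺ (R , L↻R , M⊆) = ∈-concatMap⁺ sublists (lose (∈-rotations⁺ L↻R) (∈-sublists⁺ M⊆))

consʳ : A → A × List A → A × List A
consʳ x (y , Ys) = y , x ∷ Ys

picks : List A → List (A × List A)
picks []      = []
picks (x ∷ L) = (x , L) ∷ map (consʳ x) (picks L)

∈-picks⁻ : (L : List A) {y : A} {Ys : List A} → (y , Ys) ∈ picks L → L ↭ y ∷ Ys
∈-picks⁻ (x ∷ L) (here refl) = ↭-refl
∈-picks⁻ (x ∷ L) (there yYs∈) with (y , Ys) , yYs∈′ , refl ← ∈-map⁻ (consʳ x) yYs∈ =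
  ↭-trans (Perm.prep x (∈-picks⁻ L yYs∈′)) (Perm.swap x y ↭-refl)

∈-picks⁺ : {L : List A} {y : A} → y ∈ L → ∃ λ Ys → (y , Ys) ∈ picks L
∈-picks⁺ {L = x ∷ L} (here refl) = L , here refl
∈-picks⁺ {L = x ∷ L} (there y∈) with Ys , yYs∈ ← ∈-picks⁺ y∈ = x ∷ Ys , there (∈-map⁺ (consʳ x) yYs∈)

-- (L , M , h): the cycle h is matched with the cyclic sublist M of the cycle L
Match : Set
Match = Cycle × Cycle × Cycle

Matches : (ℕ → ℕ) → Match → Set
Matches ψ (L , M , h) = h ≡ map ψ M × (M ≡ [] → L ≡ [])

mutual
  matchings : Cycles → Cycles → List (List Match)
  matchings G []      = [] ∷ []
  matchings G (h ∷ H) = concatMap (matchingsVia h H) (picks G)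

  matchingsVia : Cycle → Cycles → Cycle × Cycles → List (List Match)
  matchingsVia h H (L , rest) = concatMap (λ M → map ((L , M , h) ∷_) (matchings rest H)) (cyclicSublists L)

∈-matchings⁻ : (ψ : ℕ → ℕ) (G H : Cycles) {t : List Match} → t ∈ matchings G H → All (Matches ψ) t →
               Minor ψ G H
∈-matchings⁻ ψ G []      (here refl) [] = Minor-[] G
∈-matchings⁻ ψ G (h ∷ H) t∈ matches
  with (L , rest) , Lrest∈ , t∈′ ← find (∈-concatMap⁻ (matchingsVia h H) {xs = picks G} t∈)
  with M , M∈ , t∈″ ← find (∈-concatMap⁻ (λ M → map ((L , M , h) ∷_) (matchings rest H))
                                         {xs = cyclicSublists L} t∈′)
  with t′ , t′∈ , refl ← ∈-map⁻ ((L , M , h) ∷_) t∈″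
  with (h≡ , M≢[]) ∷ matches′ ← matches =
  Minor-↭ˡ (↭-sym (∈-picks⁻ G Lrest∈))
    (Minor-∷ (M , ∈-cyclicSublists⁻ L M∈ , h≡ , M≢[]) (∈-matchings⁻ ψ rest H t′∈ matches′))

∈-matchings⁺ : (φ : ℕ → ℕ) {S T G H : Cycles} → Pointwise (CycleMinor φ) S H → S ++ T ↭ G →
               ∃ λ t → t ∈ matchings G H × All (Matches φ) t
∈-matchings⁺ φ []                                  p = [] , here refl , []
∈-matchings⁺ φ {L ∷ S} {G = G} {h ∷ H} ((M , M⊑L , h≡ , M≢[]) ∷ pw) p
  with rest , Lrest∈ ← ∈-picks⁺ (∈-resp-↭ p (here refl))
  with t , t∈ , matches ← ∈-matchings⁺ φ pw (drop-∷ (↭-trans p (∈-picks⁻ G Lrest∈))) =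
  (L , M , h) ∷ t ,
  ∈-concatMap⁺ (matchingsVia h H)
    (lose Lrest∈ (∈-concatMap⁺ (λ M → map ((L , M , h) ∷_) (matchings rest H))
                  (lose (∈-cyclicSublists⁺ M⊑L) (∈-map⁺ ((L , M , h) ∷_) t∈)))) ,
  (h≡ , M≢[]) ∷ matches

sources targets : List Match → List ℕ
sources []              = []
sources ((_ , M , _) ∷ t) = M ++ sources t
targets []              = []
targets ((_ , _ , h) ∷ t) = h ++ targets t

tableLookup : List ℕ → List ℕ → ℕ → ℕ
tableLookup (x ∷ X) (y ∷ Y) a = if does (a ≟ x) then y else tableLookup X Y a
tableLookup _       _       a = 0

tableLookup-map : (φ : ℕ → ℕ) (X : List ℕ) {a : ℕ} → a ∈ X → tableLookup X (map φ X) a ≡ φ a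
tableLookup-map φ (x ∷ X) {a} a∈ with a ≟ x
... | yes refl rewrite dec-true (a ≟ a) refl = refl
... | no a≢x rewrite dec-false (a ≟ x) a≢x with a∈
...   | here a≡x = ⊥-elim (a≢x a≡x)
...   | there a∈X = tableLookup-map φ X a∈X

canonical : List Match → ℕ → ℕ
canonical t = tableLookup (sources t) (targets t)

targets-map : (φ : ℕ → ℕ) (t : List Match) → All (Matches φ) t → targets t ≡ map φ (sources t)
targets-map φ []                []                  = refl
targets-map φ ((L , M , h) ∷ t) ((refl , _) ∷ matches) =
  trans (cong (map φ M ++_) (targets-map φ t matches)) (sym (map-++ φ M (sources t)))

matches-agree : {φ ψ : ℕ → ℕ} (t : List Match) → (∀ {a} → a ∈ sources t → ψ a ≡ φ a) →
                All (Matches φ) t → All (Matches ψ) t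
matches-agree []                _   []                       = []
matches-agree ((L , M , h) ∷ t) ψ≗φ ((h≡ , M≢[]) ∷ matches) =
  (trans h≡ (map-cong-local (All-∈ (λ a∈ → sym (ψ≗φ (∈-++⁺ˡ a∈))))) , M≢[]) ∷
  matches-agree t (ψ≗φ ∘ ∈-++⁺ʳ M) matches

matches-canonical : (φ : ℕ → ℕ) (t : List Match) → All (Matches φ) t → All (Matches (canonical t)) t
matches-canonical φ t matches = matches-agree t agree matches
  where
  agree : ∀ {a} → a ∈ sources t → canonical t a ≡ φ a
  agree a∈ = trans (cong (λ Y → tableLookup (sources t) Y _) (targets-map φ t matches))
                   (tableLookup-map φ (sources t) a∈)

matches? : (ψ : ℕ → ℕ) (m : Match) → Dec (Matches ψ m)
matches? ψ (L , M , h) = ≡-dec _≟_ h (map ψ M) ×-dec (≡-dec _≟_ M [] →-dec ≡-dec _≟_ L [])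

-- It suffices to test the relabelling read off from the matched labels.
minor? : (G H : Cycles) → Dec (∃ λ φ → Minor φ G H)
minor? G H with any? (λ t → all? (matches? (canonical t)) t) (matchings G H)
... | yes found with t , t∈ , matches ← find found =
  yes (canonical t , ∈-matchings⁻ (canonical t) G H t∈ matches)
... | no none = no λ { (φ , minor S T H₀ pST pH pw) → lemma φ S T H₀ pST pH pw }
  where
  lemma : (φ : ℕ → ℕ) (S T H₀ : Cycles) → S ++ T ↭ G → H₀ ↭ H → Pointwise (CycleMinor φ) S H₀ → ⊥
  lemma φ S T H₀ pST pH pw with S′ , S↭ , pw′ ← Pointwise-↭ʳ pw pH
    with t , t∈ , matches ← ∈-matchings⁺ φ pw′ (↭-trans (++⁺ʳ T (↭-sym S↭)) pST) =
    none (lose t∈ (matches-canonical φ t matches))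

stateMinor? : (γ α : State) → Dec (StateMinor γ α)
stateMinor? γ α = map′ (λ (ctr≤ , φ , m) → φ , ctr≤ , m) (λ (φ , ctr≤ , m) → ctr≤ , φ , m)
                       ((ctr α ≤? ctr γ) ×-dec minor? (cyc γ) (cyc α))

_≟ᶜ_ : (L L′ : Cycle) → Dec (L ≡ L′)
_≟ᶜ_ = ≡-dec _≟_

_≟ᴰ_ : (D D′ : Cycles) → Dec (D ≡ D′)
_≟ᴰ_ = ≡-dec _≟ᶜ_

AnswerA : (γ : State) (rest : Cycles) (C₁ C₂ : Cycle) (γ′ : State) → Set
AnswerA γ rest C₁ C₂ γ′ = ∃ λ D → cyc γ′ ≡ C₁ ∷ C₂ ∷ D × D ⊆ rest × ctr γ ≡ suc (ctr γ′)

AnswerB : (γ : State) (rest : Cycles) (C : Cycle) (γ′ : State) → Set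
AnswerB γ rest C γ′ = ∃ λ D → cyc γ′ ≡ C ∷ D × D ⊆ rest × ctr γ′ ≤ ctr γ

answerA? : ∀ γ rest C₁ C₂ γ′ → Dec (AnswerA γ rest C₁ C₂ γ′)
answerA? γ rest C₁ C₂ ⟨ []         , g′ ⟩ = no λ ()
answerA? γ rest C₁ C₂ ⟨ X ∷ []     , g′ ⟩ = no λ ()
answerA? γ rest C₁ C₂ ⟨ X ∷ Y ∷ D , g′ ⟩ with X ≟ᶜ C₁ | Y ≟ᶜ C₂ | D ⊆? rest | ctr γ ≟ suc g′
... | yes refl | yes refl | yes D⊆ | yes g≡ = yes (D , refl , D⊆ , g≡)
... | no X≢    | _        | _      | _      = no λ { (_ , refl , _) → X≢ refl }
... | yes _    | no Y≢    | _      | _      = no λ { (_ , refl , _) → Y≢ refl }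
... | yes refl | yes refl | no D⊈  | _      = no λ { (_ , refl , D⊆ , _) → D⊈ D⊆ }
... | yes refl | yes refl | yes _  | no g≢  = no λ { (_ , refl , _ , g≡) → g≢ g≡ }

answerB? : ∀ γ rest C γ′ → Dec (AnswerB γ rest C γ′)
answerB? γ rest C ⟨ []    , g′ ⟩ = no λ ()
answerB? γ rest C ⟨ X ∷ D , g′ ⟩ with X ≟ᶜ C | D ⊆? rest | g′ ≤? ctr γ
... | yes refl | yes D⊆ | yes g≤ = yes (D , refl , D⊆ , g≤)
... | no X≢    | _      | _      = no λ { (_ , refl , _) → X≢ refl }
... | yes refl | no D⊈  | _      = no λ { (_ , refl , D⊆ , _) → D⊈ D⊆ }
... | yes refl | yes _  | no g≰  = no λ { (_ , refl , _ , g≤) → g≰ g≤ }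

move-same? : (γ : State) (v w : Vtx (cyc γ)) {rest : Cycles} {C₁ C₂ : Cycle} →
             split (cyc γ) v w ≡ same rest C₁ C₂ → (γ′ : State) → Dec (Move γ v w γ′)
move-same? γ v w {rest} {C₁} {C₂} eq γ′ =
  map′ to from (answerA? γ rest C₁ C₂ γ′ ⊎-dec (answerB? γ rest C₁ γ′ ⊎-dec answerB? γ rest C₂ γ′))
  where
  to : AnswerA γ rest C₁ C₂ γ′ ⊎ (AnswerB γ rest C₁ γ′ ⊎ AnswerB γ rest C₂ γ′) → Move γ v w γ′
  to (inj₁ (_ , refl , D⊆ , g≡))        = moveA eq D⊆ g≡
  to (inj₂ (inj₁ (_ , refl , D⊆ , g≤))) = moveB eq D⊆ g≤
  to (inj₂ (inj₂ (_ , refl , D⊆ , g≤))) = moveC eq D⊆ g≤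
  from : Move γ v w γ′ → AnswerA γ rest C₁ C₂ γ′ ⊎ (AnswerB γ rest C₁ γ′ ⊎ AnswerB γ rest C₂ γ′)
  from (moveA eq′ D⊆ g≡) with refl ← trans (sym eq) eq′ = inj₁ (_ , refl , D⊆ , g≡)
  from (moveB eq′ D⊆ g≤) with refl ← trans (sym eq) eq′ = inj₂ (inj₁ (_ , refl , D⊆ , g≤))
  from (moveC eq′ D⊆ g≤) with refl ← trans (sym eq) eq′ = inj₂ (inj₂ (_ , refl , D⊆ , g≤))
  from (moveD eq′)       with () ← trans (sym eq) eq′

move-diff? : (γ : State) (v w : Vtx (cyc γ)) {rest : Cycles} {C : Cycle} →
             split (cyc γ) v w ≡ diff rest C → (γ′ : State) → Dec (Move γ v w γ′)
move-diff? γ v w {rest} {C} eq γ′ = map′ to from ((cyc γ′ ≟ᴰ (C ∷ rest)) ×-dec (ctr γ′ ≟ ctr γ))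
  where
  to : cyc γ′ ≡ C ∷ rest × ctr γ′ ≡ ctr γ → Move γ v w γ′
  to (refl , refl) = moveD eq
  from : Move γ v w γ′ → cyc γ′ ≡ C ∷ rest × ctr γ′ ≡ ctr γ
  from (moveA eq′ _ _) with () ← trans (sym eq) eq′
  from (moveB eq′ _ _) with () ← trans (sym eq) eq′
  from (moveC eq′ _ _) with () ← trans (sym eq) eq′
  from (moveD eq′)     with refl ← trans (sym eq) eq′ = refl , refl

move? : (γ : State) (v w : Vtx (cyc γ)) (γ′ : State) → Dec (Move γ v w γ′)
move? γ v w γ′ with split (cyc γ) v w in eq
... | same _ _ _ = move-same? γ v w eq γ′
... | diff _ _   = move-diff? γ v w eq γ′

-- Simulating a strategy against restricted Cutter

earlierMinor? : (ss : List State) (γ′ : State) →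
                Any (λ s → StateMinor s γ′) ss ⊎ ¬ Any (λ s → ReductionEquivalent s γ′) ss
earlierMinor? []       γ′ = inj₂ λ ()
earlierMinor? (s ∷ ss) γ′ with stateMinor? s γ′
... | yes m = inj₁ (here m)
... | no ¬m with earlierMinor? ss γ′
...   | inj₁ earlier = inj₁ (there earlier)
...   | inj₂ none    = inj₂ λ { (here r) → ¬m (reductionEquivalent⇒minor s γ′ r) ; (there r) → none r }

rewind : {P : State → Set} (h : History) → Any P (states h) → ∃ λ h′ → P (current h′)
rewind h                   (here p)  = h , p
rewind (hist _ (γ ∷ past)) (there i) = rewind (hist γ past) i

chV-≡ : (σ : MarkerStrategy) (h : History) → chV σ h ≡ proj₁ (σ h)
chV-≡ σ h with σ h
... | _ = refl

chW-≡ : (σ : MarkerStrategy) (h : History) → chW σ h ≡ proj₂ (σ h)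
chW-≡ σ h with σ h
... | _ = refl

module Simulation (g₀ : ℕ) (σ : MarkerStrategy) where

  rewind-reachable : {P : State → Set} {h : History} → RReachable g₀ σ h → (i : Any P (states h)) →
                     RReachable g₀ σ (proj₁ (rewind h i))
  rewind-reachable init                (here _)  = init
  rewind-reachable (step reach move)   (here _)  = step reach move
  rewind-reachable (step reach _)      (there i) = rewind-reachable reach i

  Shadow : History → Set
  Shadow h = ∃ λ sh → StateMinor (current sh) (current h)

  shadowMove : (h : History) → Shadow h → Vtx (cyc (current h)) × Vtx (cyc (current h))
  shadowMove h (sh , m) with v′ , w′ , _ ← pull-back m (chV σ sh) (chW σ sh) = v′ , w′

  shadowStep : (h : History) (α′ : State) → Shadow h → Maybe (Shadow (extend h α′))
  shadowStep h α′ (sh , m) with pull-back m (chV σ sh) (chW σ sh)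
  ... | v′ , w′ , pb with move? (current h) v′ w′ α′
  ...   | no _ = nothing
  ...   | yes mv with γ′ , _ , m′ ← pb α′ mv with earlierMinor? (states sh) γ′
  ...     | inj₁ earlier with sh′ , m″ ← rewind sh earlier = just (sh′ , stateMinor-trans m″ m′)
  ...     | inj₂ _       = just (extend sh γ′ , m′)

  shadowOf : (α : State) (past : List State) → Maybe (Shadow (hist α past))
  shadowOf α [] with stateMinor? ⟨ [] , g₀ ⟩ α
  ... | yes m = just (start g₀ , m)
  ... | no _  = nothing
  shadowOf α′ (α ∷ past) with shadowOf α past
  ... | just s  = shadowStep (hist α past) α′ s
  ... | nothing = nothing

  shadow : (h : History) → Maybe (Shadow h)
  shadow h = shadowOf (current h) (past h)

  choose : (h : History) → Maybe (Shadow h) → Vtx (cyc (current h)) × Vtx (cyc (current h))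
  choose h (just s) = shadowMove h s
  choose h nothing  = dummyV , dummyV

  τ : MarkerStrategy
  τ h = choose h (shadow h)

  shadowStep-reachable : (h : History) (α′ : State) (s : Shadow h) → RReachable g₀ σ (proj₁ s) →
                         Move (current h) (proj₁ (shadowMove h s)) (proj₂ (shadowMove h s)) α′ →
                         ∃ λ s′ → shadowStep h α′ s ≡ just s′ × RReachable g₀ σ (proj₁ s′)
  shadowStep-reachable h α′ (sh , m) reach mv with pull-back m (chV σ sh) (chW σ sh)
  ... | v′ , w′ , pb with move? (current h) v′ w′ α′
  ...   | no ¬mv = ⊥-elim (¬mv mv)
  ...   | yes mv′ with γ′ , basic , m′ ← pb α′ mv′ with earlierMinor? (states sh) γ′
  ...     | inj₁ earlier = _ , refl , rewind-reachable reach earlier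
  ...     | inj₂ allowed = _ , refl , step reach (basic , allowed)

  shadow-extend : (h : History) (α′ : State) {s : Shadow h} → shadow h ≡ just s →
                  shadow (extend h α′) ≡ shadowStep h α′ s
  shadow-extend h α′ eq rewrite eq = refl

  shadow-reachable : (h : History) → Reachable g₀ τ h → ∃ λ s → shadow h ≡ just s × RReachable g₀ σ (proj₁ s)
  shadow-reachable _ init with stateMinor? ⟨ [] , g₀ ⟩ ⟨ [] , g₀ ⟩
  ... | yes m = _ , refl , init
  ... | no ¬m = ⊥-elim (¬m (id , ≤-refl , Minor-[] []))
  shadow-reachable _ (step {h} {α′} reach mv)
    with s , eq , rreach ← shadow-reachable h reach
    with s′ , eq′ , rreach′ ← shadowStep-reachable h α′ s rreach
           (subst₂ (λ v w → Move (current h) v w α′)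
                   (trans (chV-≡ τ h) (cong (λ s → proj₁ (choose h s)) eq))
                   (trans (chW-≡ τ h) (cong (λ s → proj₂ (choose h s)) eq)) mv) =
    s′ , trans (shadow-extend h α′ eq) eq′ , rreach′

  τ-limits : (t : ℕ) → Limits (RReachable g₀) σ t → Limits (Reachable g₀) τ t
  τ-limits t σ-limits h reach with (sh , _ , _ , m) , _ , rreach ← shadow-reachable h reach =
    ≤-trans (Minor-value m) (σ-limits sh rreach)

-- The simulation works for every initial counter.
theorem4p5 : (g₀ t : ℕ) → 1 ≤ g₀ → MarkerWinsRestricted g₀ t → MarkerWins g₀ t
theorem4p5 g₀ t _ (σ , σ-limits) = Simulation.τ g₀ σ , Simulation.τ-limits g₀ σ t σ-limits
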